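{- Let $n\geqslant1$. For every $T\in\operatorname{SYT}(n)$, $\#\phi^{ -1}(T)=\prod_{i=1}^n\sigma_i(T)$. Consequently, for every smooth function $c=c(x)$, with $D=\frac{\mathrm{d}}{\mathrm{d}x}$ and $c_k=D^kc$, $$(cD)^nc=\sum_{T\in\operatorname{SYT}(n)}\#\phi^{ -1}(T)\,w(T)=\sum_{T\in\operatorname{SYT}(n)}\left(\prod_{i=1}^n\sigma_i(T)c_i^{w_i(T)}\right)c^{n+1-\ell(\lambda(T))}.$$
   Context: $(cD)^nc$ means applying $n$ times $g\mapsto c\,Dg$ to $c$. $\operatorname{SYT}(n)$ is the set of standard Young tableaux with $n$ boxes (French convention: rows left-justified, weakly decreasing lengths from bottom to top, entries $1,\ldots,n$ each once, increasing along rows left to right and along columns bottom to top). For $T\in\operatorname{SYT}(n)$: $\ell(\lambda(T))$ is its number of rows, $w_i(T)$ the number of rows with exactly $i$ boxes, and $w(T)=c^{n+1-\ell(\lambda(T))}\prod_{i=1}^nc_i^{w_i(T)}$. For $1\leqslant i\leqslant n$, $T_i$ is the tableau obtained by deleting the entries $i+1,\ldots,n$, and $\operatorname{col}_k(T_i)$ is the size of the $k$-th column of $T_i$. Define $\sigma_i(T)=i-\operatorname{col}_1(T_i)+1$ if $i$ lies in the first column of $T$, and $\sigma_i(T)=\operatorname{col}_k(T_i)-\operatorname{col}_{k+1}(T_i)+1$ if $i$ lies in the $(k+1)$-th column, $k\geqslant1$. $\operatorname{OWP}_n$ is the set of ordered weak set partitions $p=(B_0,\ldots,B_n)$ of $[n]$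 into $n+1$ pairwise disjoint possibly empty blocks with $1\in B_0$ and $\min B_i>i$ whenever $B_i\neq\emptyset$ ($1\leqslant i\leqslant n$). The map $\phi:\operatorname{OWP}_n\to\operatorname{SYT}(n)$: represent $p$ as an array whose $(i+1)$-th row from the bottom lists the elements of $B_i$ in increasing order, left-justified; delete empty rows, reorder the rows by length in decreasing order from bottom to top, then rearrange the entries of each column in increasing order from bottom to top. $\phi^{ -1}(T)=\{p\in\operatorname{OWP}_n:\phi(p)=T\}$. -}

module Defs where

open import Level using (Level; _⊔_)
open import Data.Nat renaming (_+_ to _+ℕ_) using (ℕ; zero; suc; _∸_; _≤_; _<_; _≤ᵇ_; _≡ᵇ_; _<ᵇ_; _<?_)
open import Data.Bool using (Bool; true; false; if_then_else_)
open import Data.Fin using (Fin; toℕ; fromℕ<)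
open import Data.Vec using (Vec; []; _∷_; lookup)
open import Data.List using (List; []; _∷_; length; map; filter; filterᵇ; concat; foldr; concatMap; upTo; applyUpTo)
open import Data.Nat.ListAction using (product)
open import Data.List.Relation.Unary.Linked using (Linked)
open import Data.List.Relation.Unary.All using (All)
open import Data.List.Relation.Binary.Permutation.Propositional using (_↭_)
open import Data.Maybe using (Maybe; just; nothing)
open import Data.Unit using (⊤)
open import Data.Empty using (⊥)
open import Data.Product using (_×_; Σ)
open import Function using (_∘_)
open import Relation.Nullary using (yes; no)
open import Data.List.Membership.Propositional using (_∈_)
open import Algebra.Bundles using (CommutativeRing; Semiring)

range1 : ℕ → List ℕ
range1 n = applyUpTo suc n

nth? : List ℕ → ℕ → Maybe ℕ
nth? []       _       = nothing
nth? (x ∷ xs) zero    = just x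
nth? (x ∷ xs) (suc k) = nth? xs k

-- k-th entry (0-based) with default 0 (only used at valid indices)
nth : List ℕ → ℕ → ℕ
nth xs k with nth? xs k
... | just x  = x
... | nothing = 0

insertℕ : ℕ → List ℕ → List ℕ
insertℕ x []       = x ∷ []
insertℕ x (y ∷ ys) = if x ≤ᵇ y then x ∷ y ∷ ys else y ∷ insertℕ x ys

sortℕ : List ℕ → List ℕ
sortℕ = foldr insertℕ []

insertRow : List ℕ → List (List ℕ) → List (List ℕ)
insertRow r []       = r ∷ []
insertRow r (s ∷ ss) = if length s <ᵇ length r then r ∷ s ∷ ss else s ∷ insertRow r ss

sortRowsByLength : List (List ℕ) → List (List ℕ)
sortRowsByLength = foldr insertRow []

isNonEmpty : List ℕ → Bool
isNonEmpty []      = false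
isNonEmpty (_ ∷ _) = true

rowAt : List (List ℕ) → ℕ → List ℕ
rowAt []       _       = []
rowAt (r ∷ rs) zero    = r
rowAt (r ∷ rs) (suc j) = rowAt rs j

-- Tableaux / arrays: a list of rows, listed from BOTTOM to TOP (French
-- convention); each row lists its entries from left to right.

Array : Set
Array = List (List ℕ)

column : ℕ → Array → List ℕ
column k []       = []
column k (r ∷ rs) with nth? r k
... | just x  = x ∷ column k rs
... | nothing = column k rs

-- `Above r s` : row s sits directly on top of row r, i.e. s is not
-- longer than r and entries of s are larger than the entries below them.
Above : List ℕ → List ℕ → Set
Above _        []       = ⊤
Above []       (_ ∷ _)  = ⊥
Above (a ∷ r)  (b ∷ s)  = (a < b) × Above r s

data NonEmptyRow : List ℕ → Set where
  nonEmpty : ∀ {x xs} → NonEmptyRow (x ∷ xs)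

record IsSYT (n : ℕ) (T : Array) : Set where
  field
    rowsNonEmpty : All NonEmptyRow T
    rowsIncr     : All (Linked _<_) T
    colsIncr     : Linked Above T
    entries      : concat T ↭ range1 n

numRows : Array → ℕ
numRows = length

rowsOfLength : ℕ → Array → ℕ
rowsOfLength i T = length (filterᵇ (λ r → length r ≡ᵇ i) T)

restrict : ℕ → Array → Array
restrict i T = filterᵇ isNonEmpty (map (filterᵇ (λ x → x ≤ᵇ i)) T)

-- col_k(T) : size of the k-th column (k ≥ 1, 1-based)
col : ℕ → Array → ℕ
col k T = length (column (k ∸ 1) T)

indexIn : ℕ → List ℕ → Maybe ℕ
indexIn x []       = nothing
indexIn x (y ∷ ys) with x ≡ᵇ y
... | true  = just 0
... | false with indexIn x ys
...   | just k  = just (suc k)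
...   | nothing = nothing

-- 0-based column index of the entry x in T (x lies in column colOf x T + 1)
colOf : ℕ → Array → ℕ
colOf x []       = 0
colOf x (r ∷ rs) with indexIn x r
... | just k  = k
... | nothing = colOf x rs

-- σ_i(T): if i is in the first column, i - col_1(T_i) + 1; if i is in the
-- (k+1)-th column (k ≥ 1), col_k(T_i) - col_{k+1}(T_i) + 1.
-- (Both differences are nonnegative, so truncated subtraction is exact.)
σ : Array → ℕ → ℕ
σ T i with colOf i T
... | zero  = i ∸ col 1 (restrict i T) +ℕ 1
... | suc j = col (suc j) (restrict i T) ∸ col (suc (suc j)) (restrict i T) +ℕ 1

σProd : ℕ → Array → ℕ
σProd n T = product (map (σ T) (range1 n))

-- Ordered weak set partitions.  p = (B_0,…,B_n) of [n] is encoded by the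
-- block-assignment vector p : Vec (Fin (suc n)) n, whose j-th entry
-- (0-based) is the index i of the block B_i containing the element j+1.
-- (Pairwise disjoint blocks covering [n] ⇔ such an assignment.)

WeakPartition : ℕ → Set
WeakPartition n = Vec (Fin (suc n)) n

block : ∀ {n} → WeakPartition n → ℕ → List ℕ
block {n} p i = filterᵇ (λ e → inBlock e) (range1 n)
  where
  inBlock : ℕ → Bool
  inBlock zero    = false
  inBlock (suc j) with j <? n
  ... | yes j<n = toℕ (lookup p (fromℕ< j<n)) ≡ᵇ i
  ... | no  _   = false

-- min B_i > i whenever B_i ≠ ∅ (the head of the increasing list is the min)
MinCondition : ℕ → List ℕ → Set
MinCondition i []      = ⊤
MinCondition i (m ∷ _) = i < m

record IsOWP (n : ℕ) (p : WeakPartition n) : Set where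
  field
    oneInB₀ : 1 ∈ block p 0
    minCond : ∀ i → 1 ≤ i → i ≤ n → MinCondition i (block p i)

φ : ∀ {n} → WeakPartition n → Array
φ {n} p = rearrangeColumns sorted
  where
  sorted : Array
  sorted = sortRowsByLength (filterᵇ isNonEmpty (map (block p) (upTo (suc n))))
  -- rearrange the entries of each column increasingly from bottom to top
  rearrangeColumns : Array → Array
  rearrangeColumns A =
    map (λ j → map (λ k → nth (sortℕ (column k A)) j)
                   (upTo (length (rowAt A j))))
        (upTo (length A))

module _ {r ℓ : Level} (R : CommutativeRing r ℓ) where
  open CommutativeRing R
  open import Algebra.Definitions.RawSemiring (Semiring.rawSemiring semiring) using (_^_) renaming (_×_ to _·_)

  record IsDerivation (D : Carrier → Carrier) : Set (r ⊔ ℓ) where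
    field
      D-cong  : ∀ {x y} → x ≈ y → D x ≈ D y
      D-+     : ∀ x y → D (x + y) ≈ D x + D y
      D-*     : ∀ x y → D (x * y) ≈ D x * y + x * D y

  iterD : (Carrier → Carrier) → ℕ → Carrier → Carrier
  iterD D zero    x = x
  iterD D (suc k) x = D (iterD D k x)

  cDpow : (Carrier → Carrier) → Carrier → ℕ → Carrier
  cDpow D c zero    = c
  cDpow D c (suc k) = c * D (cDpow D c k)

  ringSum : List Carrier → Carrier
  ringSum = foldr _+_ 0#

  ringProd : List Carrier → Carrier
  ringProd = foldr _*_ 1#

  weight : (Carrier → Carrier) → Carrier → ℕ → Array → Carrier
  weight D c n T =
    (c ^ (suc n ∸ numRows T)) * ringProd (map (λ i → iterD D i c ^ rowsOfLength i T) (range1 n))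

  σTerm : (Carrier → Carrier) → Carrier → ℕ → Array → Carrier
  σTerm D c n T =
    ringProd (map (λ i → σ T i · (iterD D i c ^ rowsOfLength i T)) (range1 n))
      * (c ^ (suc n ∸ numRows T))

  natScale : ℕ → Carrier → Carrier
  natScale k x = k · x

-- Record an ordered weak set partition p by its block function, e ↦ the index of the block containing
-- e; then p ∈ OWP_n exactly when each e lies in a block of index < e.  The tableau φ(p) is standard
-- and puts e into column r + 1, where r is the number of smaller elements in the block of e; since a
-- standard tableau is determined by the columns of its entries, φ(p) = T exactly when every e has
-- this property.  So φ⁻¹(T) is built by placing 1, …, n in turn, element i joining one of the blocks
-- B_0, …, B_{i-1} that already holds k elements, when i lies in column k + 1 of T.  After placing
-- 1, …, i - 1, the blocks with more than t elements are as many as the entries of column t + 1 of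
-- T_{i-1}.  Hence for k = 0 there are i − col_1(T_i) + 1 choices (the empty blocks), and for k ≥ 1
-- there are col_k(T_i) − col_{k+1}(T_i) + 1 (the blocks of size exactly k), which is σ_i(T).
--
-- For the expansion, (cD)^(m+1) c = c · D((cD)^m c) and the Leibniz rule show by induction that
-- (cD)^n c is the sum over all p ∈ OWP_n of ∏_i c_{|B_i|}, with c_0 = c.  The rows of φ(p) are the
-- nonempty blocks of p, so this product is w(φ(p)); grouping the sum by T = φ(p) gives both formulas.

module Submission where

open import Defs
open import Level using (Level)
open import Data.Nat using (ℕ; _≤_)
open import Data.List using (List; length; map)
open import Data.List.Membership.Propositional using (_∈_)
open import Data.List.Relation.Unary.Unique.Propositional using (Unique)
open import Data.Product using (_×_; _,_)
open import Function.Bundles using (_⇔_)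
open import Relation.Binary.PropositionalEquality using (_≡_)
open import Algebra.Bundles using (CommutativeRing)

module Counting where

  open import Data.Nat using (zero; suc; _+_; _<_; z≤n; s≤s; _≡ᵇ_; _<ᵇ_; _≤ᵇ_; _≟_)
  open import Data.Nat.Properties
  open import Algebra.Properties.CommutativeSemigroup +-commutativeSemigroup using (x∙yz≈y∙xz)
  open import Data.Bool using (Bool; true; false; _∧_; T?)
  open import Data.Bool.Properties using (∧-identityʳ; ∧-zeroʳ)
  open import Data.List using ([]; _∷_; filterᵇ; upTo; _++_)
  open import Data.List.Properties using (length-applyUpTo; applyUpTo-∷ʳ)
  open import Data.List.Relation.Unary.Linked as Linked using (Linked; []; [-]; _∷_)
  open import Data.List.Relation.Unary.Linked.Properties using (Linked⇒All; applyUpTo⁺₂; filter⁺)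
  open import Data.List.Relation.Unary.All as All using (All; []; _∷_)
  open import Data.List.Relation.Unary.Any using (here; there)
  open import Data.List.Relation.Unary.AllPairs using ([]; _∷_)
  open import Data.List.Membership.Propositional using (_∉_)
  open import Data.List.Membership.Propositional.Properties using (∈-∃++; ∈-++⁺ʳ; ∈-map⁻; ∈-applyUpTo⁺; ∈-applyUpTo⁻)
  open import Data.List.Relation.Binary.Permutation.Propositional as ↭ using (_↭_; ↭-sym; ↭-refl)
  open import Data.List.Relation.Binary.Permutation.Propositional.Properties using (shift; ↭-length)
  open import Data.Product using (proj₁; proj₂)
  open import Data.Empty using (⊥; ⊥-elim)
  open import Function using (_∘_)
  open import Relation.Nullary using (¬_; yes; no)
  open import Relation.Binary.PropositionalEquality

  fromBool : Bool → ℕ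
  fromBool true  = 1
  fromBool false = 0

  fromBool≤1 : ∀ b → fromBool b ≤ 1
  fromBool≤1 true  = s≤s z≤n
  fromBool≤1 false = z≤n

  true≢false : ∀ {b : Bool} → b ≡ true → b ≡ false → ⊥
  true≢false refl ()

  count : ∀ {a} {A : Set a} → (A → Bool) → List A → ℕ
  count P []       = 0
  count P (x ∷ xs) = fromBool (P x) + count P xs

  module _ {a} {A : Set a} where

    length-filterᵇ : ∀ (P : A → Bool) xs → length (filterᵇ P xs) ≡ count P xs
    length-filterᵇ P [] = refl
    length-filterᵇ P (x ∷ xs) with P x
    ... | true  = cong suc (length-filterᵇ P xs)
    ... | false = length-filterᵇ P xs

    count-true : ∀ (xs : List A) → count (λ _ → true) xs ≡ length xs
    count-true []       = refl
    count-true (_ ∷ xs) = cong suc (count-true xs)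

    count-++ : ∀ (P : A → Bool) xs ys → count P (xs ++ ys) ≡ count P xs + count P ys
    count-++ P []       ys = refl
    count-++ P (x ∷ xs) ys = trans (cong (fromBool (P x) +_) (count-++ P xs ys)) (sym (+-assoc (fromBool (P x)) _ _))

    count-cong : ∀ (P Q : A → Bool) xs → (∀ x → x ∈ xs → P x ≡ Q x) → count P xs ≡ count Q xs
    count-cong P Q []       h = refl
    count-cong P Q (x ∷ xs) h = cong₂ _+_ (cong fromBool (h x (here refl))) (count-cong P Q xs (λ y m → h y (there m)))

    count≤length : ∀ (P : A → Bool) xs → count P xs ≤ length xs
    count≤length P []       = z≤n
    count≤length P (x ∷ xs) = +-mono-≤ (fromBool≤1 (P x)) (count≤length P xs)

    count-↭ : ∀ (P : A → Bool) {xs ys} → xs ↭ ys → count P xs ≡ count P ys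
    count-↭ P ↭.refl         = refl
    count-↭ P (↭.prep x p)   = cong (fromBool (P x) +_) (count-↭ P p)
    count-↭ P (↭.swap x y p) = trans (cong (λ k → fromBool (P x) + (fromBool (P y) + k)) (count-↭ P p))
                                     (x∙yz≈y∙xz (fromBool (P x)) (fromBool (P y)) _)
    count-↭ P (↭.trans p q)  = trans (count-↭ P p) (count-↭ P q)

    count-map : ∀ {B : Set} (Q : B → Bool) (g : A → B) xs → count Q (map g xs) ≡ count (λ x → Q (g x)) xs
    count-map Q g []       = refl
    count-map Q g (x ∷ xs) = cong (fromBool (Q (g x)) +_) (count-map Q g xs)

    count-split : ∀ (P Q R : A → Bool) xs → (∀ x → fromBool (P x) + fromBool (Q x) ≡ fromBool (R x)) →
                  count P xs + count Q xs ≡ count R xs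
    count-split P Q R []       h = refl
    count-split P Q R (x ∷ xs) h = begin
      (p + count P xs) + (q + count Q xs) ≡⟨ +-assoc p _ _ ⟩
      p + (count P xs + (q + count Q xs)) ≡⟨ cong (p +_) (x∙yz≈y∙xz (count P xs) q _) ⟩
      p + (q + (count P xs + count Q xs)) ≡⟨ sym (+-assoc p _ _) ⟩
      (p + q) + (count P xs + count Q xs) ≡⟨ cong₂ _+_ (h x) (count-split P Q R xs h) ⟩
      fromBool (R x) + count R xs         ∎
      where
      open ≡-Reasoning
      p = fromBool (P x)
      q = fromBool (Q x)

    count-filterᵇ : ∀ (P Q : A → Bool) xs → count Q (filterᵇ P xs) ≡ count (λ x → P x ∧ Q x) xs
    count-filterᵇ P Q []       = refl
    count-filterᵇ P Q (x ∷ xs) with P x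
    ... | true  = cong (fromBool (Q x) +_) (count-filterᵇ P Q xs)
    ... | false = count-filterᵇ P Q xs

    ∈-filterᵇ⁻ : ∀ (P : A → Bool) {x} xs → x ∈ filterᵇ P xs → x ∈ xs × P x ≡ true
    ∈-filterᵇ⁻ P (y ∷ xs) m with P y in eq
    ∈-filterᵇ⁻ P (y ∷ xs) (here refl) | true  = here refl , eq
    ∈-filterᵇ⁻ P (y ∷ xs) (there m)   | true  = let (a , b) = ∈-filterᵇ⁻ P xs m in there a , b
    ∈-filterᵇ⁻ P (y ∷ xs) m           | false = let (a , b) = ∈-filterᵇ⁻ P xs m in there a , b

    ∈-filterᵇ⁺ : ∀ (P : A → Bool) {x} xs → x ∈ xs → P x ≡ true → x ∈ filterᵇ P xs
    ∈-filterᵇ⁺ P (y ∷ xs) m px with P y in eq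
    ∈-filterᵇ⁺ P (y ∷ xs) (here refl) px | true  = here refl
    ∈-filterᵇ⁺ P (y ∷ xs) (there m)   px | true  = there (∈-filterᵇ⁺ P xs m px)
    ∈-filterᵇ⁺ P (y ∷ xs) (here refl) px | false = ⊥-elim (true≢false px eq)
    ∈-filterᵇ⁺ P (y ∷ xs) (there m)   px | false = ∈-filterᵇ⁺ P xs m px

    filterᵇ-accept : ∀ (P : A → Bool) {x} xs → P x ≡ true → filterᵇ P (x ∷ xs) ≡ x ∷ filterᵇ P xs
    filterᵇ-accept P xs e rewrite e = refl

    filterᵇ-reject : ∀ (P : A → Bool) {x} xs → P x ≡ false → filterᵇ P (x ∷ xs) ≡ filterᵇ P xs
    filterᵇ-reject P xs e rewrite e = refl

    filterᵇ-cong : ∀ (P Q : A → Bool) xs → (∀ x → x ∈ xs → P x ≡ Q x) → filterᵇ P xs ≡ filterᵇ Q xs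
    filterᵇ-cong P Q []       h = refl
    filterᵇ-cong P Q (x ∷ xs) h with P x | Q x | h x (here refl)
    ... | true  | true  | _ = cong (x ∷_) (filterᵇ-cong P Q xs (λ y m → h y (there m)))
    ... | false | false | _ = filterᵇ-cong P Q xs (λ y m → h y (there m))

    private
      ∈-++-∷ : ∀ {x w : A} ys {zs} → w ∈ ys ++ zs → w ∈ ys ++ x ∷ zs
      ∈-++-∷ []       m         = there m
      ∈-++-∷ (_ ∷ ys) (here e)  = here e
      ∈-++-∷ (_ ∷ ys) (there m) = there (∈-++-∷ ys m)

      ∈-++-∷⁻ : ∀ {x w : A} ys {zs} → w ∈ ys ++ x ∷ zs → ¬ w ≡ x → w ∈ ys ++ zs
      ∈-++-∷⁻ []       (here e)  ne = ⊥-elim (ne e)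
      ∈-++-∷⁻ []       (there m) ne = m
      ∈-++-∷⁻ (_ ∷ ys) (here e)  ne = here e
      ∈-++-∷⁻ (_ ∷ ys) (there m) ne = there (∈-++-∷⁻ ys m ne)

      unique-remove : ∀ (ys : List A) {zs x} → Unique (ys ++ x ∷ zs) → Unique (ys ++ zs) × x ∉ ys ++ zs
      unique-remove []       (h ∷ u) = u , λ m → All.lookup h m refl
      unique-remove (y ∷ ys) (h ∷ u) with unique-remove ys u
      ... | u′ , x∉ = All.tabulate (λ m → All.lookup h (∈-++-∷ ys m)) ∷ u′
                    , λ { (here refl) → All.lookup h (∈-++⁺ʳ ys (here refl)) refl ; (there m) → x∉ m }

    sameElements⇒↭ : ∀ {xs ys : List A} → Unique xs → Unique ys →
                     (∀ z → z ∈ xs → z ∈ ys) → (∀ z → z ∈ ys → z ∈ xs) → xs ↭ ys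
    sameElements⇒↭ {[]}     {[]}     _ _ f g = ↭-refl
    sameElements⇒↭ {[]}     {y ∷ ys} _ _ f g with () ← g y (here refl)
    sameElements⇒↭ {x ∷ xs} {ys} (x∉xs ∷ uxs) uys f g with ∈-∃++ (f x (here refl))
    ... | ys₁ , ys₂ , refl = ↭.trans (↭.prep x (sameElements⇒↭ uxs (proj₁ removed) f′ g′)) (↭-sym (shift x ys₁ ys₂))
      where
      removed = unique-remove ys₁ uys
      x∉ys = proj₂ removed
      f′ : ∀ z → z ∈ xs → z ∈ ys₁ ++ ys₂
      f′ z m = ∈-++-∷⁻ ys₁ (f z (there m)) (λ e → All.lookup x∉xs m (sym e))
      g′ : ∀ z → z ∈ ys₁ ++ ys₂ → z ∈ xs
      g′ z m with g z (∈-++-∷ ys₁ m)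
      ... | here refl = ⊥-elim (x∉ys m)
      ... | there m′  = m′

    sameElements⇒length≡ : ∀ {xs ys : List A} → Unique xs → Unique ys →
                           (∀ z → z ∈ xs → z ∈ ys) → (∀ z → z ∈ ys → z ∈ xs) → length xs ≡ length ys
    sameElements⇒length≡ uxs uys f g = ↭-length (sameElements⇒↭ uxs uys f g)

    map⁺-injectiveOn : ∀ {B : Set} (g : A → B) {xs} → Unique xs →
                       (∀ {x y} → x ∈ xs → y ∈ xs → g x ≡ g y → x ≡ y) → Unique (map g xs)
    map⁺-injectiveOn g {[]}     []        inj = []
    map⁺-injectiveOn g {x ∷ xs} (x∉ ∷ u) inj =
      All.tabulate (λ {w} m → fresh m) ∷ map⁺-injectiveOn g u (λ mx my → inj (there mx) (there my))
      where
      fresh : ∀ {w} → w ∈ map g xs → ¬ g x ≡ w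
      fresh m e with ∈-map⁻ g m
      ... | y , my , refl = All.lookup x∉ my (inj (here refl) (there my) e)

  ≡ᵇ-refl : ∀ m → (m ≡ᵇ m) ≡ true
  ≡ᵇ-refl zero    = refl
  ≡ᵇ-refl (suc m) = ≡ᵇ-refl m

  ≡ᵇ-sym : ∀ m n → (m ≡ᵇ n) ≡ (n ≡ᵇ m)
  ≡ᵇ-sym zero    zero    = refl
  ≡ᵇ-sym zero    (suc n) = refl
  ≡ᵇ-sym (suc m) zero    = refl
  ≡ᵇ-sym (suc m) (suc n) = ≡ᵇ-sym m n

  ≡ᵇ≡true⇒≡ : ∀ m n → (m ≡ᵇ n) ≡ true → m ≡ n
  ≡ᵇ≡true⇒≡ zero    zero    e = refl
  ≡ᵇ≡true⇒≡ (suc m) (suc n) e = cong suc (≡ᵇ≡true⇒≡ m n e)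

  ≢⇒≡ᵇ≡false : ∀ m n → ¬ m ≡ n → (m ≡ᵇ n) ≡ false
  ≢⇒≡ᵇ≡false zero    zero    ne = ⊥-elim (ne refl)
  ≢⇒≡ᵇ≡false zero    (suc n) ne = refl
  ≢⇒≡ᵇ≡false (suc m) zero    ne = refl
  ≢⇒≡ᵇ≡false (suc m) (suc n) ne = ≢⇒≡ᵇ≡false m n (λ e → ne (cong suc e))

  <ᵇ≡true⇒< : ∀ m n → (m <ᵇ n) ≡ true → m < n
  <ᵇ≡true⇒< zero    (suc n) e = s≤s z≤n
  <ᵇ≡true⇒< (suc m) (suc n) e = s≤s (<ᵇ≡true⇒< m n e)

  <⇒<ᵇ≡true : ∀ m n → m < n → (m <ᵇ n) ≡ true
  <⇒<ᵇ≡true zero    (suc n) _       = refl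
  <⇒<ᵇ≡true (suc m) (suc n) (s≤s l) = <⇒<ᵇ≡true m n l

  <ᵇ≡false⇒≥ : ∀ m n → (m <ᵇ n) ≡ false → n ≤ m
  <ᵇ≡false⇒≥ m       zero    e = z≤n
  <ᵇ≡false⇒≥ (suc m) (suc n) e = s≤s (<ᵇ≡false⇒≥ m n e)

  ≥⇒<ᵇ≡false : ∀ m n → n ≤ m → (m <ᵇ n) ≡ false
  ≥⇒<ᵇ≡false m       zero    _       = refl
  ≥⇒<ᵇ≡false (suc m) (suc n) (s≤s l) = ≥⇒<ᵇ≡false m n l

  ≤ᵇ≡true⇒≤ : ∀ m n → (m ≤ᵇ n) ≡ true → m ≤ n
  ≤ᵇ≡true⇒≤ zero    n e = z≤n
  ≤ᵇ≡true⇒≤ (suc m) n e = <ᵇ≡true⇒< m n e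

  ≤⇒≤ᵇ≡true : ∀ m n → m ≤ n → (m ≤ᵇ n) ≡ true
  ≤⇒≤ᵇ≡true zero    n _ = refl
  ≤⇒≤ᵇ≡true (suc m) n l = <⇒<ᵇ≡true m n l

  ≤ᵇ≡false⇒> : ∀ m n → (m ≤ᵇ n) ≡ false → n < m
  ≤ᵇ≡false⇒> (suc m) n e = s≤s (<ᵇ≡false⇒≥ m n e)

  >⇒≤ᵇ≡false : ∀ m n → n < m → (m ≤ᵇ n) ≡ false
  >⇒≤ᵇ≡false (suc m) n (s≤s l) = ≥⇒<ᵇ≡false m n l

  <ᵇ-suc : ∀ x m → (x <ᵇ suc m) ≡ (x ≤ᵇ m)
  <ᵇ-suc zero    m = refl
  <ᵇ-suc (suc x) m = refl

  Increasing : List ℕ → Set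
  Increasing = Linked _<_

  Increasing-head< : ∀ {x xs} → Increasing (x ∷ xs) → ∀ {y} → y ∈ xs → x < y
  Increasing-head< [-]       ()
  Increasing-head< (x<y ∷ l) m = All.lookup (Linked⇒All <-trans x<y l) m

  Increasing-head≤ : ∀ {x xs} → Increasing (x ∷ xs) → ∀ {y} → y ∈ x ∷ xs → x ≤ y
  Increasing-head≤ l (here refl) = ≤-refl
  Increasing-head≤ l (there m)   = <⇒≤ (Increasing-head< l m)

  Increasing-∷ : ∀ {x xs} → (∀ {y} → y ∈ xs → x < y) → Increasing xs → Increasing (x ∷ xs)
  Increasing-∷ {xs = []}    h l = [-]
  Increasing-∷ {xs = y ∷ _} h l = h (here refl) ∷ l

  Increasing-filterᵇ : ∀ (P : ℕ → Bool) {xs} → Increasing xs → Increasing (filterᵇ P xs)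
  Increasing-filterᵇ P = filter⁺ (T? ∘ P) <-trans

  Increasing-upTo : ∀ m → Increasing (upTo m)
  Increasing-upTo m = applyUpTo⁺₂ _ m (λ i → ≤-refl)

  Increasing-range1 : ∀ m → Increasing (range1 m)
  Increasing-range1 m = applyUpTo⁺₂ suc m (λ i → ≤-refl)

  Increasing-ext : ∀ {xs ys} → Increasing xs → Increasing ys →
                   (∀ z → z ∈ xs → z ∈ ys) → (∀ z → z ∈ ys → z ∈ xs) → xs ≡ ys
  Increasing-ext {[]}     {[]}     _ _ f g = refl
  Increasing-ext {[]}     {y ∷ ys} _ _ f g with () ← g y (here refl)
  Increasing-ext {x ∷ xs} {[]}     _ _ f g with () ← f x (here refl)
  Increasing-ext {x ∷ xs} {y ∷ ys} lx ly f g
    with refl ← ≤-antisym (Increasing-head≤ ly (f x (here refl))) (Increasing-head≤ lx (g y (here refl)))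
    = cong (x ∷_) (Increasing-ext (Linked.tail lx) (Linked.tail ly) (drop lx f) (drop ly g))
    where
    drop : ∀ {zs zs′} → Increasing (x ∷ zs) → (∀ z → z ∈ x ∷ zs → z ∈ x ∷ zs′) → ∀ z → z ∈ zs → z ∈ zs′
    drop l h z m with h z (there m)
    ... | here refl = ⊥-elim (<-irrefl refl (Increasing-head< l m))
    ... | there m′  = m′

  occ : ℕ → List ℕ → ℕ
  occ z = count (z ≡ᵇ_)

  AtMostOnce : List ℕ → Set
  AtMostOnce xs = ∀ e → occ e xs ≤ 1

  occ>0⇒∈ : ∀ z ys → 0 < occ z ys → z ∈ ys
  occ>0⇒∈ z (y ∷ ys) h with z ≡ᵇ y in e
  ... | true  = here (≡ᵇ≡true⇒≡ z y e)
  ... | false = there (occ>0⇒∈ z ys h)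

  ∈⇒occ>0 : ∀ {e} xs → e ∈ xs → 0 < occ e xs
  ∈⇒occ>0 {e} (x ∷ xs) (here refl) rewrite ≡ᵇ-refl e = s≤s z≤n
  ∈⇒occ>0 {e} (x ∷ xs) (there m)   = ≤-trans (∈⇒occ>0 xs m) (m≤n+m _ (fromBool (e ≡ᵇ x)))

  ∉⇒occ≡0 : ∀ {e} xs → e ∉ xs → occ e xs ≡ 0
  ∉⇒occ≡0 []            e∉ = refl
  ∉⇒occ≡0 {e} (x ∷ xs) e∉ with e ≡ᵇ x in eq
  ... | true  = ⊥-elim (e∉ (here (≡ᵇ≡true⇒≡ e x eq)))
  ... | false = ∉⇒occ≡0 xs (λ m → e∉ (there m))

  occ≗⇒↭ : ∀ xs ys → (∀ z → occ z xs ≡ occ z ys) → xs ↭ ys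
  occ≗⇒↭ []       []       h = ↭-refl
  occ≗⇒↭ []       (y ∷ ys) h with () ← trans (h y) (cong (λ b → fromBool b + occ y ys) (≡ᵇ-refl y))
  occ≗⇒↭ (x ∷ xs) ys       h with ∈-∃++ (occ>0⇒∈ x ys (subst (0 <_) (h x) (∈⇒occ>0 (x ∷ xs) (here refl))))
  ... | ys₁ , ys₂ , refl = ↭.trans (↭.prep x (occ≗⇒↭ xs (ys₁ ++ ys₂) h′)) (↭-sym (shift x ys₁ ys₂))
    where
    h′ : ∀ z → occ z xs ≡ occ z (ys₁ ++ ys₂)
    h′ z = +-cancelˡ-≡ δ _ _ (begin
      δ + occ z xs                 ≡⟨ h z ⟩
      occ z (ys₁ ++ x ∷ ys₂)       ≡⟨ count-++ (z ≡ᵇ_) ys₁ (x ∷ ys₂) ⟩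
      occ z ys₁ + (δ + occ z ys₂)  ≡⟨ x∙yz≈y∙xz (occ z ys₁) δ (occ z ys₂) ⟩
      δ + (occ z ys₁ + occ z ys₂)  ≡⟨ cong (δ +_) (sym (count-++ (z ≡ᵇ_) ys₁ ys₂)) ⟩
      δ + occ z (ys₁ ++ ys₂)       ∎)
      where
      open ≡-Reasoning
      δ = fromBool (z ≡ᵇ x)

  Increasing⇒AtMostOnce : ∀ {xs} → Increasing xs → AtMostOnce xs
  Increasing⇒AtMostOnce {[]}     l e = z≤n
  Increasing⇒AtMostOnce {x ∷ xs} l e with e ≡ᵇ x in eq
  ... | true rewrite ≡ᵇ≡true⇒≡ e x eq | ∉⇒occ≡0 {x} xs (λ m → <-irrefl refl (Increasing-head< l m)) = s≤s z≤n
  ... | false = Increasing⇒AtMostOnce (Linked.tail l) e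

  AtMostOnce-tail : ∀ {x xs} → AtMostOnce (x ∷ xs) → AtMostOnce xs
  AtMostOnce-tail {x} d e = ≤-trans (m≤n+m _ (fromBool (e ≡ᵇ x))) (d e)

  AtMostOnce-head : ∀ {x xs} → AtMostOnce (x ∷ xs) → x ∉ xs
  AtMostOnce-head {x} {xs} d m with d x
  ... | h rewrite ≡ᵇ-refl x = <-irrefl refl (≤-trans (s≤s (∈⇒occ>0 xs m)) h)

  AtMostOnce-++ˡ : ∀ xs ys → AtMostOnce (xs ++ ys) → AtMostOnce xs
  AtMostOnce-++ˡ xs ys d e = ≤-trans (m≤m+n _ _) (subst (_≤ 1) (count-++ (e ≡ᵇ_) xs ys) (d e))

  AtMostOnce-++ʳ : ∀ xs ys → AtMostOnce (xs ++ ys) → AtMostOnce ys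
  AtMostOnce-++ʳ xs ys d e = ≤-trans (m≤n+m _ _) (subst (_≤ 1) (count-++ (e ≡ᵇ_) xs ys) (d e))

  AtMostOnce-++-disjoint : ∀ xs ys {e} → AtMostOnce (xs ++ ys) → e ∈ xs → e ∈ ys → ⊥
  AtMostOnce-++-disjoint xs ys {e} d m₁ m₂ =
    <-irrefl refl (≤-trans (+-mono-≤ (∈⇒occ>0 xs m₁) (∈⇒occ>0 ys m₂)) (subst (_≤ 1) (count-++ (e ≡ᵇ_) xs ys) (d e)))

  AtMostOnce⇒occ≡1 : ∀ e xs → AtMostOnce xs → e ∈ xs → occ e xs ≡ 1
  AtMostOnce⇒occ≡1 e xs d m = ≤-antisym (d e) (∈⇒occ>0 xs m)

  sameElements⇒occ≡ : ∀ e xs ys → AtMostOnce xs → AtMostOnce ys →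
                      (∀ z → z ∈ xs → z ∈ ys) → (∀ z → z ∈ ys → z ∈ xs) → occ e xs ≡ occ e ys
  sameElements⇒occ≡ e xs ys dx dy f g with occ e xs in ex
  ... | suc _ = let m = occ>0⇒∈ e xs (subst (0 <_) (sym ex) (s≤s z≤n)) in
                trans (trans (sym ex) (AtMostOnce⇒occ≡1 e xs dx m)) (sym (AtMostOnce⇒occ≡1 e ys dy (f e m)))
  ... | zero  = sym (∉⇒occ≡0 ys (λ m → 0≢1+n (trans (sym ex) (AtMostOnce⇒occ≡1 e xs dx (g e m)))))

  range1-snoc : ∀ m → range1 (suc m) ≡ range1 m ++ suc m ∷ []
  range1-snoc m = sym (applyUpTo-∷ʳ suc m)

  ∈-range1⁻ : ∀ {e m} → e ∈ range1 m → 1 ≤ e × e ≤ m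
  ∈-range1⁻ m with ∈-applyUpTo⁻ suc m
  ... | i , i<m , refl = s≤s z≤n , i<m

  ∈-range1⁺ : ∀ {e m} → 1 ≤ e → e ≤ m → e ∈ range1 m
  ∈-range1⁺ {suc e} (s≤s _) l = ∈-applyUpTo⁺ suc l

  occ-range1 : ∀ v m → 1 ≤ v → v ≤ m → occ v (range1 m) ≡ 1
  occ-range1 v m l₁ l₂ = AtMostOnce⇒occ≡1 v (range1 m) (Increasing⇒AtMostOnce (Increasing-range1 m)) (∈-range1⁺ l₁ l₂)

  countUpTo : (ℕ → Bool) → ℕ → ℕ
  countUpTo P m = count P (range1 m)

  countUpTo-suc : ∀ P m → countUpTo P (suc m) ≡ countUpTo P m + fromBool (P (suc m))
  countUpTo-suc P m = begin
    count P (range1 (suc m))                         ≡⟨ cong (count P) (range1-snoc m) ⟩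
    count P (range1 m ++ suc m ∷ [])                 ≡⟨ count-++ P (range1 m) (suc m ∷ []) ⟩
    countUpTo P m + (fromBool (P (suc m)) + 0)       ≡⟨ cong (countUpTo P m +_) (+-identityʳ _) ⟩
    countUpTo P m + fromBool (P (suc m))             ∎
    where open ≡-Reasoning

  countUpTo≤ : ∀ P m → countUpTo P m ≤ m
  countUpTo≤ P m = subst (countUpTo P m ≤_) (length-applyUpTo suc m) (count≤length P (range1 m))

  countUpTo-cong : ∀ P Q m → (∀ e → 1 ≤ e → e ≤ m → P e ≡ Q e) → countUpTo P m ≡ countUpTo Q m
  countUpTo-cong P Q m h = count-cong P Q (range1 m) (λ e mem → let (a , b) = ∈-range1⁻ mem in h e a b)

  countUpTo-prefix : ∀ (P : ℕ → Bool) i n → i ≤ n → count (λ e → P e ∧ (e ≤ᵇ i)) (range1 n) ≡ countUpTo P i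
  countUpTo-prefix P i zero    z≤n = refl
  countUpTo-prefix P i (suc n) le with i ≟ suc n
  ... | yes refl = count-cong _ _ (range1 (suc n)) (λ e m →
                     trans (cong (P e ∧_) (≤⇒≤ᵇ≡true e (suc n) (proj₂ (∈-range1⁻ m)))) (∧-identityʳ (P e)))
  ... | no i≢ = begin
    count Q (range1 (suc n))                       ≡⟨ cong (count Q) (range1-snoc n) ⟩
    count Q (range1 n ++ suc n ∷ [])               ≡⟨ count-++ Q (range1 n) (suc n ∷ []) ⟩
    count Q (range1 n) + (fromBool (Q (suc n)) + 0) ≡⟨ cong₂ _+_ (countUpTo-prefix P i n (≤-pred i<)) (cong (λ b → fromBool b + 0) Q-last) ⟩
    countUpTo P i + 0                              ≡⟨ +-identityʳ _ ⟩
    countUpTo P i                                  ∎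
    where
    open ≡-Reasoning
    Q = λ e → P e ∧ (e ≤ᵇ i)
    i< = ≤∧≢⇒< le i≢
    Q-last : Q (suc n) ≡ false
    Q-last = trans (cong (P (suc n) ∧_) (>⇒≤ᵇ≡false (suc n) i i<)) (∧-zeroʳ (P (suc n)))

module Arrays where

  open Counting
  open import Data.Nat using (zero; suc; _+_; _<_; z≤n; s≤s; _≡ᵇ_; _<ᵇ_; _≤ᵇ_; _≟_; _<?_)
  open import Data.Nat.Properties
  open import Algebra.Properties.CommutativeSemigroup +-commutativeSemigroup using (x∙yz≈y∙xz)
  open import Data.Bool using (Bool; true; false)
  open import Data.Maybe using (Maybe; just; nothing)
  open import Data.Maybe.Properties using (just-injective)
  open import Data.Maybe.Relation.Binary.Connected using (Connected; just)
  open import Data.List using ([]; _∷_; filterᵇ; concat; _++_; applyUpTo; head)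
  open import Data.List.Properties using (∷-injective)
  open import Data.List.Relation.Unary.Linked as Linked using (Linked; []; [-]; _∷_; _∷′_)
  open import Data.List.Relation.Unary.All using (All; []; _∷_)
  open import Data.List.Relation.Unary.Any using (here; there)
  open import Data.List.Membership.Propositional using (_∉_)
  open import Data.List.Membership.Propositional.Properties using (∈-++⁺ˡ; ∈-++⁺ʳ; ∈-++⁻)
  open import Data.List.Relation.Binary.Permutation.Propositional as ↭ using (_↭_; ↭-refl)
  open import Data.Product using (proj₁; proj₂; ∃)
  open import Data.Sum using (inj₁; inj₂)
  open import Data.Empty using (⊥; ⊥-elim)
  open import Data.Unit using (tt)
  open import Relation.Nullary using (yes; no)
  open import Function using (_∘_)
  open import Relation.Binary.PropositionalEquality

  nth?-∈ : ∀ r k {e} → nth? r k ≡ just e → e ∈ r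
  nth?-∈ (x ∷ r) zero    refl = here refl
  nth?-∈ (x ∷ r) (suc k) h    = there (nth?-∈ r k h)

  ∈⇒nth? : ∀ {r e} → e ∈ r → ∃ λ k → nth? r k ≡ just e
  ∈⇒nth? (here refl) = 0 , refl
  ∈⇒nth? (there m)   = let (k , h) = ∈⇒nth? m in suc k , h

  nth?-ext : ∀ (r s : List ℕ) → (∀ k → nth? r k ≡ nth? s k) → r ≡ s
  nth?-ext []      []      h = refl
  nth?-ext []      (y ∷ s) h with () ← h 0
  nth?-ext (x ∷ r) []      h with () ← h 0
  nth?-ext (x ∷ r) (y ∷ s) h with refl ← h 0 = cong (x ∷_) (nth?-ext r s (λ k → h (suc k)))

  nth?-unique : ∀ r k k′ {e} → AtMostOnce r → nth? r k ≡ just e → nth? r k′ ≡ just e → k ≡ k′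
  nth?-unique (x ∷ r) zero    zero     d h    h′   = refl
  nth?-unique (x ∷ r) zero    (suc k′) d refl h′   = ⊥-elim (AtMostOnce-head d (nth?-∈ r k′ h′))
  nth?-unique (x ∷ r) (suc k) zero     d h    refl = ⊥-elim (AtMostOnce-head d (nth?-∈ r k h))
  nth?-unique (x ∷ r) (suc k) (suc k′) d h    h′   = cong suc (nth?-unique r k k′ (AtMostOnce-tail {x} {r} d) h h′)

  column-∷-just : ∀ k r rs {e} → nth? r k ≡ just e → column k (r ∷ rs) ≡ e ∷ column k rs
  column-∷-just k r rs h with nth? r k
  column-∷-just k r rs refl | just x = refl

  column-∷-nothing : ∀ k r rs → nth? r k ≡ nothing → column k (r ∷ rs) ≡ column k rs
  column-∷-nothing k r rs h with nth? r k
  column-∷-nothing k r rs refl | nothing = refl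

  ∈-column⇒∈-concat : ∀ k T {e} → e ∈ column k T → e ∈ concat T
  ∈-column⇒∈-concat k (r ∷ rs) m with nth? r k in eq
  ∈-column⇒∈-concat k (r ∷ rs) (here refl) | just x  = ∈-++⁺ˡ (nth?-∈ r k eq)
  ∈-column⇒∈-concat k (r ∷ rs) (there m)   | just x  = ∈-++⁺ʳ r (∈-column⇒∈-concat k rs m)
  ∈-column⇒∈-concat k (r ∷ rs) m           | nothing = ∈-++⁺ʳ r (∈-column⇒∈-concat k rs m)

  ∈-concat⇒∈-column : ∀ T {e} → e ∈ concat T → ∃ λ k → e ∈ column k T
  ∈-concat⇒∈-column (r ∷ rs) m with ∈-++⁻ r m
  ... | inj₁ mr = let (k , h) = ∈⇒nth? mr in k , subst (_ ∈_) (sym (column-∷-just k r rs h)) (here refl)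
  ... | inj₂ mrs with ∈-concat⇒∈-column rs mrs
  ... | k , mk with nth? r k in eq
  ... | just x  = k , subst (_ ∈_) (sym (column-∷-just k r rs eq)) (there mk)
  ... | nothing = k , subst (_ ∈_) (sym (column-∷-nothing k r rs eq)) mk

  Above-nth? : ∀ r s k {y} → Above r s → nth? s k ≡ just y → ∃ λ x → nth? r k ≡ just x × x < y
  Above-nth? (a ∷ r) (b ∷ s) zero    (a<b , _) refl = a , refl , a<b
  Above-nth? (a ∷ r) (b ∷ s) (suc k) (_ , ab)  h    = Above-nth? r s k ab h

  Above-nothing : ∀ r s k → Above r s → nth? r k ≡ nothing → nth? s k ≡ nothing
  Above-nothing r s k ab h with nth? s k in eq
  ... | nothing = refl
  ... | just y with Above-nth? r s k ab eq
  ...   | x , e , _ with () ← trans (sym e) h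

  column-above-nothing : ∀ r rs k → Linked Above (r ∷ rs) → nth? r k ≡ nothing → column k rs ≡ []
  column-above-nothing r []       k l        h = refl
  column-above-nothing r (s ∷ rs) k (ab ∷ l) h =
    trans (column-∷-nothing k s rs hs) (column-above-nothing s rs k l hs)
    where hs = Above-nothing r s k ab h

  column-above-just : ∀ r rs k {x y} → Linked Above (r ∷ rs) → nth? r k ≡ just x → y ∈ column k rs → x < y
  column-above-just r (s ∷ rs) k l h m with nth? s k in eq
  column-above-just r (s ∷ rs) k (ab ∷ l) h (here refl) | just _ with Above-nth? r s k ab eq
  ... | _ , e , lt rewrite just-injective (trans (sym h) e) = lt
  column-above-just r (s ∷ rs) k (ab ∷ l) h (there m)   | just _ with Above-nth? r s k ab eq
  ... | _ , e , lt rewrite just-injective (trans (sym h) e) = <-trans lt (column-above-just s rs k l eq m)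
  column-above-just r (s ∷ rs) k (ab ∷ l) h m           | nothing rewrite column-above-nothing s rs k l eq with () ← m

  Increasing-column : ∀ k T → Linked Above T → Increasing (column k T)
  Increasing-column k []       l = []
  Increasing-column k (r ∷ rs) l with nth? r k in eq
  ... | just x  = Increasing-∷ (column-above-just r rs k l eq) (Increasing-column k rs (Linked.tail l))
  ... | nothing = Increasing-column k rs (Linked.tail l)

  column-non-empty : ∀ r rs k {x} → nth? r k ≡ just x → column k (r ∷ rs) ≡ [] → ⊥
  column-non-empty r rs k h e rewrite column-∷-just k r rs h with () ← e

  ≡-by-columns : ∀ X Y → All NonEmptyRow X → All NonEmptyRow Y → Linked Above X → Linked Above Y →
                 (∀ k → column k X ≡ column k Y) → X ≡ Y
  ≡-by-columns []       []       _             _             _  _  h = refl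
  ≡-by-columns []       (s ∷ ss) _             (nonEmpty ∷ _) _  _  h = ⊥-elim (column-non-empty s ss 0 refl (sym (h 0)))
  ≡-by-columns (r ∷ rs) []       (nonEmpty ∷ _) _             _  _  h = ⊥-elim (column-non-empty r rs 0 refl (h 0))
  ≡-by-columns (r ∷ rs) (s ∷ ss) (_ ∷ nr)      (_ ∷ ns)      lr ls h =
    cong₂ _∷_ (nth?-ext r s (proj₁ ∘ split)) (≡-by-columns rs ss nr ns (Linked.tail lr) (Linked.tail ls) (proj₂ ∘ split))
    where
    split : ∀ k → nth? r k ≡ nth? s k × column k rs ≡ column k ss
    split k with nth? r k in e₁ | nth? s k in e₂
    ... | just x  | just y  =
      let (a , b) = ∷-injective (trans (sym (column-∷-just k r rs e₁)) (trans (h k) (column-∷-just k s ss e₂))) in cong just a , b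
    ... | just x  | nothing = ⊥-elim (column-non-empty r rs k e₁
                                (trans (h k) (trans (column-∷-nothing k s ss e₂) (column-above-nothing s ss k ls e₂))))
    ... | nothing | just y  = ⊥-elim (column-non-empty s ss k e₂
                                (trans (sym (h k)) (trans (column-∷-nothing k r rs e₁) (column-above-nothing r rs k lr e₁))))
    ... | nothing | nothing = refl , trans (column-above-nothing r rs k lr e₁) (sym (column-above-nothing s ss k ls e₂))

  indexIn-just : ∀ e r {j} → indexIn e r ≡ just j → nth? r j ≡ just e
  indexIn-just e (y ∷ ys) h with e ≡ᵇ y in eq
  indexIn-just e (y ∷ ys) refl | true rewrite ≡ᵇ≡true⇒≡ e y eq = refl
  ... | false with indexIn e ys in eq₂
  indexIn-just e (y ∷ ys) refl | false | just k = indexIn-just e ys eq₂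

  indexIn-nothing : ∀ e r → indexIn e r ≡ nothing → e ∉ r
  indexIn-nothing e (y ∷ ys) h m with e ≡ᵇ y in eq
  indexIn-nothing e (y ∷ ys) () m | true
  ... | false with indexIn e ys in eq₂
  indexIn-nothing e (y ∷ ys) () m          | false | just k
  indexIn-nothing e (y ∷ ys) h (here refl) | false | nothing rewrite ≡ᵇ-refl e = true≢false refl eq
  indexIn-nothing e (y ∷ ys) h (there m)   | false | nothing = indexIn-nothing e ys eq₂ m

  colOf-∷-∉ : ∀ e r rs → e ∉ r → colOf e (r ∷ rs) ≡ colOf e rs
  colOf-∷-∉ e r rs e∉ with indexIn e r in eq
  ... | just j  = ⊥-elim (e∉ (nth?-∈ r j (indexIn-just e r eq)))
  ... | nothing = refl

  colOf-∷-nth? : ∀ e r rs k → AtMostOnce r → nth? r k ≡ just e → colOf e (r ∷ rs) ≡ k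
  colOf-∷-nth? e r rs k d h with indexIn e r in eq
  ... | just j  = nth?-unique r j k d (indexIn-just e r eq) h
  ... | nothing = ⊥-elim (indexIn-nothing e r eq (nth?-∈ r k h))

  colOf-∷-below : ∀ k r rs {e} → AtMostOnce (r ++ concat rs) → e ∈ column k rs → colOf e (r ∷ rs) ≡ colOf e rs
  colOf-∷-below k r rs d m = colOf-∷-∉ _ r rs (λ mr → AtMostOnce-++-disjoint r (concat rs) d mr (∈-column⇒∈-concat k rs m))

  ∈-column⇒colOf≡ : ∀ k T {e} → AtMostOnce (concat T) → e ∈ column k T → colOf e T ≡ k
  ∈-column⇒colOf≡ k (r ∷ rs) {e} d m with nth? r k in eq
  ∈-column⇒colOf≡ k (r ∷ rs) {e} d (here refl) | just x  = colOf-∷-nth? e r rs k (AtMostOnce-++ˡ r (concat rs) d) eq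
  ∈-column⇒colOf≡ k (r ∷ rs) {e} d (there m)   | just x  =
    trans (colOf-∷-below k r rs d m) (∈-column⇒colOf≡ k rs (AtMostOnce-++ʳ r (concat rs) d) m)
  ∈-column⇒colOf≡ k (r ∷ rs) {e} d m           | nothing =
    trans (colOf-∷-below k r rs d m) (∈-column⇒colOf≡ k rs (AtMostOnce-++ʳ r (concat rs) d) m)

  colOf≡⇒∈-column : ∀ k T {e} → AtMostOnce (concat T) → e ∈ concat T → colOf e T ≡ k → e ∈ column k T
  colOf≡⇒∈-column k T d m h with ∈-concat⇒∈-column T m
  ... | k′ , mk′ rewrite sym h | ∈-column⇒colOf≡ k′ T d mk′ = mk′

  column-filterᵇ-isNonEmpty : ∀ k X → column k (filterᵇ isNonEmpty X) ≡ column k X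
  column-filterᵇ-isNonEmpty k []            = refl
  column-filterᵇ-isNonEmpty k ([] ∷ X)      = column-filterᵇ-isNonEmpty k X
  column-filterᵇ-isNonEmpty k ((x ∷ r) ∷ X) with nth? (x ∷ r) k
  ... | just y  = cong (y ∷_) (column-filterᵇ-isNonEmpty k X)
  ... | nothing = column-filterᵇ-isNonEmpty k X

  atMost : ℕ → List ℕ → List ℕ
  atMost i = filterᵇ (λ x → x ≤ᵇ i)

  atMost-above : ∀ i r → (∀ {z} → z ∈ r → i < z) → atMost i r ≡ []
  atMost-above i []      h = refl
  atMost-above i (y ∷ r) h =
    trans (filterᵇ-reject (λ x → x ≤ᵇ i) {y} r (>⇒≤ᵇ≡false y i (h (here refl)))) (atMost-above i r (h ∘ there))

  data EntryCase (i : ℕ) (r : List ℕ) (k : ℕ) : Set where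
    kept    : ∀ x → nth? r k ≡ just x → x ≤ i → nth? (atMost i r) k ≡ just x → EntryCase i r k
    dropped : ∀ x → nth? r k ≡ just x → i < x → nth? (atMost i r) k ≡ nothing → EntryCase i r k
    absent  : nth? r k ≡ nothing → nth? (atMost i r) k ≡ nothing → EntryCase i r k

  entryCase : ∀ i r k → Increasing r → EntryCase i r k
  entryCase i []      k l = absent refl refl
  entryCase i (y ∷ r) k l with y ≤ᵇ i in eq
  ... | true = accepted k
    where
    shift : ∀ k → nth? (atMost i (y ∷ r)) (suc k) ≡ nth? (atMost i r) k
    shift k = cong (λ z → nth? z (suc k)) (filterᵇ-accept (λ x → x ≤ᵇ i) {y} r eq)
    accepted : ∀ k → EntryCase i (y ∷ r) k
    accepted zero    = kept y refl (≤ᵇ≡true⇒≤ y i eq) (cong (λ z → nth? z 0) (filterᵇ-accept (λ x → x ≤ᵇ i) {y} r eq))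
    accepted (suc k) with entryCase i r k (Linked.tail l)
    ... | kept x a b c    = kept x a b (trans (shift k) c)
    ... | dropped x a b c = dropped x a b (trans (shift k) c)
    ... | absent a b      = absent a (trans (shift k) b)
  ... | false = rejected (nth? (y ∷ r) k) refl
    where
    none-left : nth? (atMost i (y ∷ r)) k ≡ nothing
    none-left = cong (λ z → nth? z k) (trans (filterᵇ-reject (λ x → x ≤ᵇ i) {y} r eq)
                  (atMost-above i r (λ m → <-trans (≤ᵇ≡false⇒> y i eq) (Increasing-head< l m))))
    rejected : ∀ mx → nth? (y ∷ r) k ≡ mx → EntryCase i (y ∷ r) k
    rejected nothing  e = absent e none-left
    rejected (just x) e = dropped x e (≤-trans (≤ᵇ≡false⇒> y i eq) (Increasing-head≤ l (nth?-∈ (y ∷ r) k e))) none-left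

  column-map-atMost : ∀ i k T → All Increasing T → column k (map (atMost i) T) ≡ atMost i (column k T)
  column-map-atMost i k []      _        = refl
  column-map-atMost i k (r ∷ T) (l ∷ ls) with entryCase i r k l
  ... | kept x a b c
    rewrite column-∷-just k (atMost i r) (map (atMost i) T) c | column-∷-just k r T a | ≤⇒≤ᵇ≡true x i b
    = cong (x ∷_) (column-map-atMost i k T ls)
  ... | dropped x a b c
    rewrite column-∷-nothing k (atMost i r) (map (atMost i) T) c | column-∷-just k r T a | >⇒≤ᵇ≡false x i b
    = column-map-atMost i k T ls
  ... | absent a b
    rewrite column-∷-nothing k (atMost i r) (map (atMost i) T) b | column-∷-nothing k r T a
    = column-map-atMost i k T ls

  column-restrict : ∀ i k T → All Increasing T → column k (restrict i T) ≡ atMost i (column k T)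
  column-restrict i k T ls = trans (column-filterᵇ-isNonEmpty k (map (atMost i) T)) (column-map-atMost i k T ls)

  nth?-suc-left : ∀ r k {y} → Increasing r → nth? r (suc k) ≡ just y → ∃ λ x → nth? r k ≡ just x × x < y
  nth?-suc-left (a ∷ b ∷ r) zero    (a<b ∷ l) refl = a , refl , a<b
  nth?-suc-left (a ∷ r)     (suc k) l         h    = nth?-suc-left r k (Linked.tail l) h

  column-dominance : ∀ T → All Increasing T → ∀ k t →
                     count (λ y → y ≤ᵇ t) (column (suc k) T) ≤ count (λ x → x <ᵇ t) (column k T)
  column-dominance []      _        k t = z≤n
  column-dominance (r ∷ T) (l ∷ ls) k t = by-cases (nth? r (suc k)) refl
    where
    Goal = count (λ y → y ≤ᵇ t) (column (suc k) (r ∷ T)) ≤ count (λ x → x <ᵇ t) (column k (r ∷ T))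
    grow : ∀ mx → nth? r k ≡ mx → count (λ x → x <ᵇ t) (column k T) ≤ count (λ x → x <ᵇ t) (column k (r ∷ T))
    grow (just x) e rewrite column-∷-just k r T e    = m≤n+m _ (fromBool (x <ᵇ t))
    grow nothing  e rewrite column-∷-nothing k r T e = ≤-refl
    by-cases : ∀ my → nth? r (suc k) ≡ my → Goal
    by-cases nothing  e₁ rewrite column-∷-nothing (suc k) r T e₁ =
      ≤-trans (column-dominance T ls k t) (grow (nth? r k) refl)
    by-cases (just y) e₁ with nth?-suc-left r k l e₁
    ... | x , e₂ , x<y rewrite column-∷-just (suc k) r T e₁ | column-∷-just k r T e₂ =
      +-mono-≤ (entry≤ (y ≤ᵇ t) (x <ᵇ t) refl refl) (column-dominance T ls k t)
      where
      entry≤ : ∀ b c → (y ≤ᵇ t) ≡ b → (x <ᵇ t) ≡ c → fromBool b ≤ fromBool c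
      entry≤ false c     _ _  = z≤n
      entry≤ true  true  _ _  = ≤-refl
      entry≤ true  false e e′ = ⊥-elim (<-irrefl refl (≤-trans x<y (≤-trans (≤ᵇ≡true⇒≤ y t e) (<ᵇ≡false⇒≥ x t e′))))

  Sorted≤ : List ℕ → Set
  Sorted≤ = Linked _≤_

  insertℕ-↭ : ∀ x xs → insertℕ x xs ↭ x ∷ xs
  insertℕ-↭ x []       = ↭-refl
  insertℕ-↭ x (y ∷ ys) with x ≤ᵇ y
  ... | true  = ↭-refl
  ... | false = ↭.trans (↭.prep y (insertℕ-↭ x ys)) (↭.swap y x ↭-refl)

  sortℕ-↭ : ∀ xs → sortℕ xs ↭ xs
  sortℕ-↭ []       = ↭-refl
  sortℕ-↭ (x ∷ xs) = ↭.trans (insertℕ-↭ x (sortℕ xs)) (↭.prep x (sortℕ-↭ xs))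

  insertℕ-head : ∀ x y ys → y ≤ x → Sorted≤ (y ∷ ys) → Connected _≤_ (just y) (head (insertℕ x ys))
  insertℕ-head x y []       y≤x l         = just y≤x
  insertℕ-head x y (z ∷ zs) y≤x (y≤z ∷ l) with x ≤ᵇ z
  ... | true  = just y≤x
  ... | false = just y≤z

  insertℕ-sorted : ∀ x xs → Sorted≤ xs → Sorted≤ (insertℕ x xs)
  insertℕ-sorted x []       l = [-]
  insertℕ-sorted x (y ∷ ys) l with x ≤ᵇ y in eq
  ... | true  = ≤ᵇ≡true⇒≤ x y eq ∷ l
  ... | false = insertℕ-head x y ys (<⇒≤ (≤ᵇ≡false⇒> x y eq)) l ∷′ insertℕ-sorted x ys (Linked.tail l)

  sortℕ-sorted : ∀ xs → Sorted≤ (sortℕ xs)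
  sortℕ-sorted []       = []
  sortℕ-sorted (x ∷ xs) = insertℕ-sorted x (sortℕ xs) (sortℕ-sorted xs)

  Sorted≤∧AtMostOnce⇒Increasing : ∀ {xs} → Sorted≤ xs → AtMostOnce xs → Increasing xs
  Sorted≤∧AtMostOnce⇒Increasing []  d = []
  Sorted≤∧AtMostOnce⇒Increasing [-] d = [-]
  Sorted≤∧AtMostOnce⇒Increasing {x ∷ y ∷ xs} (x≤y ∷ l) d with x ≟ y
  ... | yes refl = ⊥-elim (AtMostOnce-head {x} {x ∷ xs} d (here refl))
  ... | no x≢y   = ≤∧≢⇒< x≤y x≢y ∷ Sorted≤∧AtMostOnce⇒Increasing l (AtMostOnce-tail {x} {y ∷ xs} d)

  LengthsDecreasing : Array → Set
  LengthsDecreasing = Linked (λ r s → length s ≤ length r)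

  insertRow-↭ : ∀ r rs → insertRow r rs ↭ r ∷ rs
  insertRow-↭ r []       = ↭-refl
  insertRow-↭ r (s ∷ ss) with length s <ᵇ length r
  ... | true  = ↭-refl
  ... | false = ↭.trans (↭.prep s (insertRow-↭ r ss)) (↭.swap s r ↭-refl)

  sortRowsByLength-↭ : ∀ rs → sortRowsByLength rs ↭ rs
  sortRowsByLength-↭ []       = ↭-refl
  sortRowsByLength-↭ (r ∷ rs) = ↭.trans (insertRow-↭ r (sortRowsByLength rs)) (↭.prep r (sortRowsByLength-↭ rs))

  insertRow-head : ∀ r s ss → length r ≤ length s → LengthsDecreasing (s ∷ ss) →
                   Connected (λ r s → length s ≤ length r) (just s) (head (insertRow r ss))
  insertRow-head r s []       r≤s l         = just r≤s
  insertRow-head r s (t ∷ ts) r≤s (t≤s ∷ l) with length t <ᵇ length r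
  ... | true  = just r≤s
  ... | false = just t≤s

  insertRow-sorted : ∀ r rs → LengthsDecreasing rs → LengthsDecreasing (insertRow r rs)
  insertRow-sorted r []       l = [-]
  insertRow-sorted r (s ∷ ss) l with length s <ᵇ length r in eq
  ... | true  = <⇒≤ (<ᵇ≡true⇒< _ _ eq) ∷ l
  ... | false = insertRow-head r s ss (<ᵇ≡false⇒≥ _ _ eq) l ∷′ insertRow-sorted r ss (Linked.tail l)

  sortRowsByLength-sorted : ∀ rs → LengthsDecreasing (sortRowsByLength rs)
  sortRowsByLength-sorted []       = []
  sortRowsByLength-sorted (r ∷ rs) = insertRow-sorted r (sortRowsByLength rs) (sortRowsByLength-sorted rs)

  consMaybe : Maybe ℕ → List ℕ → List ℕ
  consMaybe (just x) l = x ∷ l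
  consMaybe nothing  l = l

  column-∷ : ∀ k r X → column k (r ∷ X) ≡ consMaybe (nth? r k) (column k X)
  column-∷ k r X with nth? r k
  ... | just x  = refl
  ... | nothing = refl

  consMaybe-↭ : ∀ m {l l′} → l ↭ l′ → consMaybe m l ↭ consMaybe m l′
  consMaybe-↭ (just x) p = ↭.prep x p
  consMaybe-↭ nothing  p = p

  consMaybe-swap : ∀ a b {l l′} → l ↭ l′ → consMaybe a (consMaybe b l) ↭ consMaybe b (consMaybe a l′)
  consMaybe-swap (just x) (just y) p = ↭.swap x y p
  consMaybe-swap (just x) nothing  p = ↭.prep x p
  consMaybe-swap nothing  (just y) p = ↭.prep y p
  consMaybe-swap nothing  nothing  p = p

  column-↭ : ∀ k {X Y} → X ↭ Y → column k X ↭ column k Y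
  column-↭ k ↭.refl = ↭-refl
  column-↭ k (↭.prep {xs = X} {ys = Y} r p) =
    subst₂ _↭_ (sym (column-∷ k r X)) (sym (column-∷ k r Y)) (consMaybe-↭ (nth? r k) (column-↭ k p))
  column-↭ k (↭.swap {xs = X} {ys = Y} r s p) =
    subst₂ _↭_ (sym (trans (column-∷ k r (s ∷ X)) (cong (consMaybe (nth? r k)) (column-∷ k s X))))
               (sym (trans (column-∷ k s (r ∷ Y)) (cong (consMaybe (nth? s k)) (column-∷ k r Y))))
               (consMaybe-swap (nth? r k) (nth? s k) (column-↭ k p))
  column-↭ k (↭.trans p q) = ↭.trans (column-↭ k p) (column-↭ k q)

  count-concat-↭ : ∀ (P : ℕ → Bool) {X Y : Array} → X ↭ Y → count P (concat X) ≡ count P (concat Y)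
  count-concat-↭ P ↭.refl = refl
  count-concat-↭ P (↭.prep {xs = X} {ys = Y} r p)
    rewrite count-++ P r (concat X) | count-++ P r (concat Y) = cong (count P r +_) (count-concat-↭ P p)
  count-concat-↭ P (↭.swap {xs = X} {ys = Y} r s p)
    rewrite count-++ P r (s ++ concat X) | count-++ P s (concat X) | count-++ P s (r ++ concat Y)
          | count-++ P r (concat Y) | count-concat-↭ P p = x∙yz≈y∙xz (count P r) (count P s) _
  count-concat-↭ P (↭.trans p q) = trans (count-concat-↭ P p) (count-concat-↭ P q)

  count-concat-filterᵇ-isNonEmpty : ∀ P X → count P (concat (filterᵇ isNonEmpty X)) ≡ count P (concat X)
  count-concat-filterᵇ-isNonEmpty P []            = refl
  count-concat-filterᵇ-isNonEmpty P ([] ∷ X)      = count-concat-filterᵇ-isNonEmpty P X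
  count-concat-filterᵇ-isNonEmpty P ((x ∷ r) ∷ X) = cong (fromBool (P x) +_) (begin
    count P (r ++ concat (filterᵇ isNonEmpty X))   ≡⟨ count-++ P r _ ⟩
    count P r + count P (concat (filterᵇ isNonEmpty X)) ≡⟨ cong (count P r +_) (count-concat-filterᵇ-isNonEmpty P X) ⟩
    count P r + count P (concat X)                 ≡⟨ count-++ P r _ ⟨
    count P (r ++ concat X)                        ∎)
    where open ≡-Reasoning

  ∈-filterᵇ-isNonEmpty⁻ : ∀ {r} X → r ∈ filterᵇ isNonEmpty X → r ∈ X × NonEmptyRow r
  ∈-filterᵇ-isNonEmpty⁻ ([] ∷ X)      m           = let (a , b) = ∈-filterᵇ-isNonEmpty⁻ X m in there a , b
  ∈-filterᵇ-isNonEmpty⁻ ((x ∷ r) ∷ X) (here refl) = here refl , nonEmpty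
  ∈-filterᵇ-isNonEmpty⁻ ((x ∷ r) ∷ X) (there m)   = let (a , b) = ∈-filterᵇ-isNonEmpty⁻ X m in there a , b

  nth?≡just⇒nth≡ : ∀ xs k {x} → nth? xs k ≡ just x → nth xs k ≡ x
  nth?≡just⇒nth≡ xs k h with nth? xs k
  nth?≡just⇒nth≡ xs k refl | just x = refl

  nth-suc : ∀ x xs k → nth (x ∷ xs) (suc k) ≡ nth xs k
  nth-suc x xs k with nth? xs k
  ... | just y  = refl
  ... | nothing = refl

  nth?-< : ∀ xs k → k < length xs → ∃ λ x → nth? xs k ≡ just x
  nth?-< (x ∷ xs) zero    _       = x , refl
  nth?-< (x ∷ xs) (suc k) (s≤s l) = nth?-< xs k l

  nth?-≥ : ∀ xs k → length xs ≤ k → nth? xs k ≡ nothing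
  nth?-≥ []       k       _       = refl
  nth?-≥ (x ∷ xs) (suc k) (s≤s l) = nth?-≥ xs k l

  nth?≡just-nth : ∀ xs k → k < length xs → nth? xs k ≡ just (nth xs k)
  nth?≡just-nth xs k l with nth?-< xs k l
  ... | x , e = trans e (cong just (sym (nth?≡just⇒nth≡ xs k e)))

  applyUpTo-cong : ∀ {A : Set} (f g : ℕ → A) l → (∀ i → i < l → f i ≡ g i) → applyUpTo f l ≡ applyUpTo g l
  applyUpTo-cong f g zero    h = refl
  applyUpTo-cong f g (suc l) h = cong₂ _∷_ (h 0 (s≤s z≤n)) (applyUpTo-cong (f ∘ suc) (g ∘ suc) l (λ i lt → h (suc i) (s≤s lt)))

  applyUpTo-nth : ∀ xs → applyUpTo (nth xs) (length xs) ≡ xs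
  applyUpTo-nth []       = refl
  applyUpTo-nth (x ∷ xs) = cong (x ∷_) (trans (applyUpTo-cong _ _ (length xs) (λ i _ → nth-suc x xs i)) (applyUpTo-nth xs))

  nth?-applyUpTo : ∀ (g : ℕ → ℕ) l k → k < l → nth? (applyUpTo g l) k ≡ just (g k)
  nth?-applyUpTo g (suc l) zero    _        = refl
  nth?-applyUpTo g (suc l) (suc k) (s≤s lt) = nth?-applyUpTo (g ∘ suc) l k lt

  nth-applyUpTo : ∀ (g : ℕ → ℕ) l k → k < l → nth (applyUpTo g l) k ≡ g k
  nth-applyUpTo g l k lt = nth?≡just⇒nth≡ (applyUpTo g l) k (nth?-applyUpTo g l k lt)

  nth-<-suc : ∀ xs j → Increasing xs → suc j < length xs → nth xs j < nth xs (suc j)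
  nth-<-suc (x ∷ y ∷ xs) zero    (lt ∷ l) _        = subst (x <_) (sym (nth-suc x (y ∷ xs) 0)) lt
  nth-<-suc (x ∷ xs)     (suc j) l        (s≤s lt) =
    subst₂ _<_ (sym (nth-suc x xs j)) (sym (nth-suc x xs (suc j))) (nth-<-suc xs j (Linked.tail l) lt)

  nth?-Increasing⁻ : ∀ xs k {e} → Increasing xs → nth? xs k ≡ just e → count (λ x → x <ᵇ e) xs ≡ k
  nth?-Increasing⁻ (x ∷ xs) zero l refl rewrite ≥⇒<ᵇ≡false x x ≤-refl = none-below xs (λ m → Increasing-head< l m)
    where
    none-below : ∀ ys → (∀ {y} → y ∈ ys → x < y) → count (λ y → y <ᵇ x) ys ≡ 0
    none-below []       h = refl
    none-below (y ∷ ys) h rewrite ≥⇒<ᵇ≡false y x (<⇒≤ (h (here refl))) = none-below ys (h ∘ there)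
  nth?-Increasing⁻ (x ∷ xs) (suc k) {e} l h rewrite <⇒<ᵇ≡true x e (Increasing-head< l (nth?-∈ xs k h)) =
    cong suc (nth?-Increasing⁻ xs k (Linked.tail l) h)

  nth?-Increasing⁺ : ∀ xs {e} → Increasing xs → e ∈ xs → nth? xs (count (λ x → x <ᵇ e) xs) ≡ just e
  nth?-Increasing⁺ xs l m with ∈⇒nth? m
  ... | k , h rewrite nth?-Increasing⁻ xs k l h = h

  count≤nth : ∀ ys j → Increasing ys → j < length ys → suc j ≤ count (λ y → y ≤ᵇ nth ys j) ys
  count≤nth (y ∷ ys) zero    l _        rewrite ≤⇒≤ᵇ≡true y y ≤-refl = s≤s z≤n
  count≤nth (y ∷ ys) (suc j) l (s≤s lt) = subst (λ t → suc (suc j) ≤ count (λ y′ → y′ ≤ᵇ t) (y ∷ ys)) (sym (nth-suc y ys j)) step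
    where
    step : suc (suc j) ≤ count (λ y′ → y′ ≤ᵇ nth ys j) (y ∷ ys)
    step rewrite ≤⇒≤ᵇ≡true y (nth ys j) (<⇒≤ (Increasing-head< l (nth?-∈ ys j (nth?≡just-nth ys j lt)))) =
      s≤s (count≤nth ys j (Linked.tail l) lt)

  count<⇒nth< : ∀ xs j t → Increasing xs → j < count (λ x → x <ᵇ t) xs → nth xs j < t
  count<⇒nth< (x ∷ xs) j t l lt with x <ᵇ t in eq
  count<⇒nth< (x ∷ xs) zero    t l lt       | true = <ᵇ≡true⇒< x t eq
  count<⇒nth< (x ∷ xs) (suc j) t l (s≤s lt) | true = subst (_< t) (sym (nth-suc x xs j)) (count<⇒nth< xs j t (Linked.tail l) lt)
  ... | false = ⊥-elim (n≮0 (subst (j <_) (none-below xs (λ m → ≤-trans (<ᵇ≡false⇒≥ x t eq) (<⇒≤ (Increasing-head< l m)))) lt))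
    where
    none-below : ∀ ys → (∀ {y} → y ∈ ys → t ≤ y) → count (λ y → y <ᵇ t) ys ≡ 0
    none-below []       h = refl
    none-below (y ∷ ys) h rewrite ≥⇒<ᵇ≡false y t (h (here refl)) = none-below ys (h ∘ there)

  dominance⇒nth< : ∀ xs ys → Increasing xs → Increasing ys →
                   (∀ t → count (λ y → y ≤ᵇ t) ys ≤ count (λ x → x <ᵇ t) xs) →
                   ∀ j → j < length ys → nth xs j < nth ys j
  dominance⇒nth< xs ys ixs iys h j lt = count<⇒nth< xs j (nth ys j) ixs (≤-trans (count≤nth ys j iys lt) (h (nth ys j)))

  countBelow : (ℕ → Bool) → ℕ → ℕ
  countBelow P zero    = 0
  countBelow P (suc N) = fromBool (P 0) + countBelow (P ∘ suc) N

  countBelow-cong : ∀ P Q N → (∀ j → P j ≡ Q j) → countBelow P N ≡ countBelow Q N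
  countBelow-cong P Q zero    h = refl
  countBelow-cong P Q (suc N) h = cong₂ _+_ (cong fromBool (h 0)) (countBelow-cong (P ∘ suc) (Q ∘ suc) N (h ∘ suc))

  countBelow-none : ∀ P N → (∀ j → P j ≡ false) → countBelow P N ≡ 0
  countBelow-none P zero    h = refl
  countBelow-none P (suc N) h rewrite h 0 = countBelow-none (P ∘ suc) N (h ∘ suc)

  Decreasing : (ℕ → ℕ) → Set
  Decreasing L = ∀ j → L (suc j) ≤ L j

  Decreasing⇒≤L0 : ∀ L → Decreasing L → ∀ j → L j ≤ L 0
  Decreasing⇒≤L0 L dec zero    = ≤-refl
  Decreasing⇒≤L0 L dec (suc j) = ≤-trans (Decreasing⇒≤L0 (L ∘ suc) (dec ∘ suc) j) (dec 0)

  <countBelow⇒< : ∀ L k N → Decreasing L → ∀ j → j < countBelow (λ j → k <ᵇ L j) N → k < L j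
  <countBelow⇒< L k (suc N) dec j lt with k <ᵇ L 0 in eq
  <countBelow⇒< L k (suc N) dec zero    lt       | true = <ᵇ≡true⇒< k (L 0) eq
  <countBelow⇒< L k (suc N) dec (suc j) (s≤s lt) | true = <countBelow⇒< (L ∘ suc) k N (dec ∘ suc) j lt
  ... | false rewrite countBelow-none (λ j → k <ᵇ L (suc j)) N
                        (λ j → ≥⇒<ᵇ≡false k (L (suc j)) (≤-trans (Decreasing⇒≤L0 L dec (suc j)) (<ᵇ≡false⇒≥ k (L 0) eq)))
    with () ← lt

  <⇒<countBelow : ∀ L k N → Decreasing L → ∀ j → j < N → k < L j → j < countBelow (λ j → k <ᵇ L j) N
  <⇒<countBelow L k (suc N) dec zero    _        lt rewrite <⇒<ᵇ≡true k (L 0) lt = s≤s z≤n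
  <⇒<countBelow L k (suc N) dec (suc j) (s≤s jN) lt rewrite <⇒<ᵇ≡true k (L 0) (<-≤-trans lt (Decreasing⇒≤L0 L dec (suc j))) =
    s≤s (<⇒<countBelow (L ∘ suc) k N (dec ∘ suc) j jN lt)

  length-consMaybe-nth? : ∀ r k → length (consMaybe (nth? r k) []) ≡ fromBool (k <ᵇ length r)
  length-consMaybe-nth? r k with k <? length r
  ... | yes lt rewrite <⇒<ᵇ≡true k (length r) lt with nth?-< r k lt
  ...   | x , e rewrite e = refl
  length-consMaybe-nth? r k | no k≮ rewrite ≥⇒<ᵇ≡false k (length r) (≮⇒≥ k≮) | nth?-≥ r k (≮⇒≥ k≮) = refl

  length-consMaybe : ∀ m l → length (consMaybe m l) ≡ length (consMaybe m []) + length l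
  length-consMaybe (just x) l = refl
  length-consMaybe nothing  l = refl

  length-column : ∀ k X → length (column k X) ≡ countBelow (λ j → k <ᵇ length (rowAt X j)) (length X)
  length-column k []      = refl
  length-column k (r ∷ X) = begin
    length (column k (r ∷ X))                                        ≡⟨ cong length (column-∷ k r X) ⟩
    length (consMaybe (nth? r k) (column k X))                       ≡⟨ length-consMaybe (nth? r k) (column k X) ⟩
    length (consMaybe (nth? r k) []) + length (column k X)           ≡⟨ cong₂ _+_ (length-consMaybe-nth? r k) (length-column k X) ⟩
    countBelow (λ j → k <ᵇ length (rowAt (r ∷ X) j)) (length (r ∷ X)) ∎
    where open ≡-Reasoning

  column-applyUpTo-short : ∀ (G : ℕ → List ℕ) N k → (∀ j → length (G j) ≤ k) → column k (applyUpTo G N) ≡ []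
  column-applyUpTo-short G zero    k h = refl
  column-applyUpTo-short G (suc N) k h = begin
    column k (G 0 ∷ applyUpTo (G ∘ suc) N)
      ≡⟨ column-∷ k (G 0) _ ⟩
    consMaybe (nth? (G 0) k) (column k (applyUpTo (G ∘ suc) N))
      ≡⟨ cong (λ m → consMaybe m (column k (applyUpTo (G ∘ suc) N))) (nth?-≥ (G 0) k (h 0)) ⟩
    column k (applyUpTo (G ∘ suc) N)
      ≡⟨ column-applyUpTo-short (G ∘ suc) N k (h ∘ suc) ⟩
    [] ∎
    where open ≡-Reasoning

  column-applyUpTo : ∀ (G : ℕ → List ℕ) N k → Decreasing (length ∘ G) →
                     column k (applyUpTo G N) ≡ applyUpTo (λ j → nth (G j) k) (countBelow (λ j → k <ᵇ length (G j)) N)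
  column-applyUpTo G zero    k dec = refl
  column-applyUpTo G (suc N) k dec with k <? length (G 0)
  ... | yes lt rewrite <⇒<ᵇ≡true k (length (G 0)) lt | column-∷ k (G 0) (applyUpTo (G ∘ suc) N) | nth?≡just-nth (G 0) k lt =
    cong (nth (G 0) k ∷_) (column-applyUpTo (G ∘ suc) N k (dec ∘ suc))
  ... | no k≮ rewrite ≥⇒<ᵇ≡false k (length (G 0)) (≮⇒≥ k≮)
                    | countBelow-none (λ j → k <ᵇ length (G (suc j))) N
                        (λ j → ≥⇒<ᵇ≡false k _ (≤-trans (Decreasing⇒≤L0 (length ∘ G) dec (suc j)) (≮⇒≥ k≮)))
    = column-applyUpTo-short G (suc N) k (λ j → ≤-trans (Decreasing⇒≤L0 (length ∘ G) dec j) (≮⇒≥ k≮))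

  Above-applyUpTo : ∀ (a b : ℕ → ℕ) la lb → lb ≤ la → (∀ k → k < lb → a k < b k) → Above (applyUpTo a la) (applyUpTo b lb)
  Above-applyUpTo a b la       zero     le       h = tt
  Above-applyUpTo a b (suc la) (suc lb) (s≤s le) h =
    h 0 (s≤s z≤n) , Above-applyUpTo (a ∘ suc) (b ∘ suc) la lb le (λ k lt → h (suc k) (s≤s lt))

  sumBelow : (ℕ → ℕ) → ℕ → ℕ
  sumBelow h zero    = 0
  sumBelow h (suc K) = h 0 + sumBelow (h ∘ suc) K

  sumBelow-cong : ∀ h h′ K → (∀ k → k < K → h k ≡ h′ k) → sumBelow h K ≡ sumBelow h′ K
  sumBelow-cong h h′ zero    e = refl
  sumBelow-cong h h′ (suc K) e = cong₂ _+_ (e 0 (s≤s z≤n)) (sumBelow-cong (h ∘ suc) (h′ ∘ suc) K (λ k lt → e (suc k) (s≤s lt)))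

  sumBelow-+ : ∀ h h′ K → sumBelow (λ k → h k + h′ k) K ≡ sumBelow h K + sumBelow h′ K
  sumBelow-+ h h′ zero    = refl
  sumBelow-+ h h′ (suc K) rewrite sumBelow-+ (h ∘ suc) (h′ ∘ suc) K =
    trans (+-assoc (h 0) (h′ 0) _) (trans (cong (h 0 +_) (x∙yz≈y∙xz (h′ 0) (sumBelow (h ∘ suc) K) _)) (sym (+-assoc (h 0) _ _)))

  sumBelow-zero : ∀ K → sumBelow (λ _ → 0) K ≡ 0
  sumBelow-zero zero    = refl
  sumBelow-zero (suc K) = sumBelow-zero K

  count-consMaybe : ∀ P m l → count P (consMaybe m l) ≡ count P (consMaybe m []) + count P l
  count-consMaybe P (just x) l = cong (_+ count P l) (sym (+-identityʳ _))
  count-consMaybe P nothing  l = refl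

  count-by-entries : ∀ P r K → length r ≤ K → count P r ≡ sumBelow (λ k → count P (consMaybe (nth? r k) [])) K
  count-by-entries P []      K       le       = sym (sumBelow-zero K)
  count-by-entries P (x ∷ r) (suc K) (s≤s le) = cong₂ _+_ (sym (+-identityʳ _)) (count-by-entries P r K le)

  count-concat-by-columns : ∀ P X K → (∀ {r} → r ∈ X → length r ≤ K) →
                            count P (concat X) ≡ sumBelow (λ k → count P (column k X)) K
  count-concat-by-columns P []      K h = sym (sumBelow-zero K)
  count-concat-by-columns P (r ∷ X) K h = begin
    count P (r ++ concat X)                                         ≡⟨ count-++ P r (concat X) ⟩
    count P r + count P (concat X)                                  ≡⟨ cong₂ _+_ (count-by-entries P r K (h (here refl)))
                                                                                 (count-concat-by-columns P X K (h ∘ there)) ⟩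
    sumBelow entry K + sumBelow (λ k → count P (column k X)) K      ≡⟨ sumBelow-+ _ _ K ⟨
    sumBelow (λ k → entry k + count P (column k X)) K               ≡⟨ sumBelow-cong _ _ K (λ k _ → column-step k) ⟩
    sumBelow (λ k → count P (column k (r ∷ X))) K                   ∎
    where
    open ≡-Reasoning
    entry = λ k → count P (consMaybe (nth? r k) [])
    column-step : ∀ k → entry k + count P (column k X) ≡ count P (column k (r ∷ X))
    column-step k = trans (sym (count-consMaybe P (nth? r k) (column k X))) (cong (count P) (sym (column-∷ k r X)))

  ∈-column⁺ : ∀ k X {r e} → r ∈ X → nth? r k ≡ just e → e ∈ column k X
  ∈-column⁺ k (r ∷ X) (here refl) h rewrite column-∷-just k r X h = here refl
  ∈-column⁺ k (r ∷ X) {e = e} (there m) h = subst (e ∈_) (sym (column-∷ k r X)) (lift (nth? r k))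
    where
    lift : ∀ mx → e ∈ consMaybe mx (column k X)
    lift (just x) = there (∈-column⁺ k X m h)
    lift nothing  = ∈-column⁺ k X m h

  occ-column≤occ-concat : ∀ e k X → occ e (column k X) ≤ occ e (concat X)
  occ-column≤occ-concat e k [] = z≤n
  occ-column≤occ-concat e k (r ∷ X)
    rewrite column-∷ k r X | count-consMaybe (e ≡ᵇ_) (nth? r k) (column k X) | count-++ (e ≡ᵇ_) r (concat X) =
    +-mono-≤ (entry≤ (nth? r k) refl) (occ-column≤occ-concat e k X)
    where
    entry≤ : ∀ mx → nth? r k ≡ mx → occ e (consMaybe mx []) ≤ occ e r
    entry≤ nothing  _ = z≤n
    entry≤ (just x) h with e ≡ᵇ x in eq
    ... | false = z≤n
    ... | true rewrite ≡ᵇ≡true⇒≡ e x eq = ∈⇒occ>0 r (nth?-∈ r k h)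

  rowAt-∈ : ∀ X j → j < length X → rowAt X j ∈ X
  rowAt-∈ (r ∷ X) zero    _        = here refl
  rowAt-∈ (r ∷ X) (suc j) (s≤s lt) = there (rowAt-∈ X j lt)

  LengthsDecreasing⇒Decreasing : ∀ X → LengthsDecreasing X → Decreasing (λ j → length (rowAt X j))
  LengthsDecreasing⇒Decreasing []          l        j       = z≤n
  LengthsDecreasing⇒Decreasing (r ∷ [])    l        zero    = z≤n
  LengthsDecreasing⇒Decreasing (r ∷ [])    l        (suc j) = z≤n
  LengthsDecreasing⇒Decreasing (r ∷ s ∷ X) (le ∷ l) zero    = le
  LengthsDecreasing⇒Decreasing (r ∷ s ∷ X) (le ∷ l) (suc j) = LengthsDecreasing⇒Decreasing (s ∷ X) l j

  length-rowAt≤ : ∀ X K → (∀ {r} → r ∈ X → length r ≤ K) → ∀ j → length (rowAt X j) ≤ K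
  length-rowAt≤ []      K h j       = z≤n
  length-rowAt≤ (r ∷ X) K h zero    = h (here refl)
  length-rowAt≤ (r ∷ X) K h (suc j) = length-rowAt≤ X K (h ∘ there) j

module Tableaux where

  open Counting
  open Arrays
  open import Data.Maybe using (just)
  open import Data.Nat using (zero; suc; pred; _+_; _<_; z≤n; s≤s; _≡ᵇ_; _<ᵇ_; _≤ᵇ_; _<?_)
  open import Data.Nat.Properties
  open import Data.Bool using (Bool; true; false; _∧_)
  open import Data.Fin using (toℕ; fromℕ<)
  open import Data.Fin.Properties using (toℕ<n)
  open import Data.Vec using (lookup)
  open import Data.List using ([]; _∷_; filterᵇ; concat; applyUpTo; upTo)
  open import Data.List.Properties using (length-applyUpTo; map-upTo)
  open import Data.List.Relation.Unary.Linked using (Linked)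
  import Data.List.Relation.Unary.Linked.Properties as Linked
  import Data.List.Relation.Unary.All.Properties as AllP
  open import Data.List.Relation.Unary.All as All using (All; []; _∷_)
  open import Data.List.Relation.Unary.Any using (here; there)
  open import Data.List.Membership.Propositional.Properties
    using (∈-map⁺; ∈-map⁻; ∈-upTo⁺; ∈-upTo⁻; ∈-concat⁺′; ∈-concat⁻′; ∈-applyUpTo⁻)
  open import Data.List.Relation.Binary.Permutation.Propositional using (_↭_; ↭-sym)
  open import Data.List.Relation.Binary.Permutation.Propositional.Properties using (∈-resp-↭; ↭-length)
  open import Data.Product using (proj₁; proj₂; ∃)
  open import Data.Empty using (⊥-elim)
  open import Function using (_∘_)
  open import Relation.Nullary using (¬_; yes; no)
  open import Relation.Binary.PropositionalEquality

  inColumn : Array → ℕ → ℕ → Bool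
  inColumn T k e = colOf e T ≡ᵇ k

  countUpTo-inColumn-own : ∀ T m {k} → colOf (suc m) T ≡ k → countUpTo (inColumn T k) (suc m) ≡ countUpTo (inColumn T k) m + 1
  countUpTo-inColumn-own T m {k} col≡ = begin
    countUpTo (inColumn T k) (suc m)                             ≡⟨ countUpTo-suc (inColumn T k) m ⟩
    countUpTo (inColumn T k) m + fromBool (colOf (suc m) T ≡ᵇ k) ≡⟨ cong (λ z → countUpTo (inColumn T k) m + fromBool (z ≡ᵇ k)) col≡ ⟩
    countUpTo (inColumn T k) m + fromBool (k ≡ᵇ k)               ≡⟨ cong (λ b → countUpTo (inColumn T k) m + fromBool b) (≡ᵇ-refl k) ⟩
    countUpTo (inColumn T k) m + 1                               ∎
    where open ≡-Reasoning

  countUpTo-inColumn-other : ∀ T m {k} → ¬ colOf (suc m) T ≡ k → countUpTo (inColumn T k) (suc m) ≡ countUpTo (inColumn T k) m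
  countUpTo-inColumn-other T m {k} col≢ = begin
    countUpTo (inColumn T k) (suc m)                             ≡⟨ countUpTo-suc (inColumn T k) m ⟩
    countUpTo (inColumn T k) m + fromBool (colOf (suc m) T ≡ᵇ k)
      ≡⟨ cong (λ b → countUpTo (inColumn T k) m + fromBool b) (≢⇒≡ᵇ≡false _ k col≢) ⟩
    countUpTo (inColumn T k) m + 0                               ≡⟨ +-identityʳ _ ⟩
    countUpTo (inColumn T k) m                                   ∎
    where open ≡-Reasoning

  module _ {n : ℕ} {T : Array} (S : IsSYT n T) where
    open IsSYT S

    SYT-AtMostOnce : AtMostOnce (concat T)
    SYT-AtMostOnce e = subst (_≤ 1) (sym (count-↭ (e ≡ᵇ_) entries)) (Increasing⇒AtMostOnce (Increasing-range1 n) e)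

    SYT-column : ∀ k → column k T ≡ filterᵇ (inColumn T k) (range1 n)
    SYT-column k = Increasing-ext (Increasing-column k T colsIncr) (Increasing-filterᵇ _ (Increasing-range1 n))
      (λ e m → ∈-filterᵇ⁺ _ (range1 n) (∈-resp-↭ entries (∈-column⇒∈-concat k T m))
                 (subst (λ z → (z ≡ᵇ k) ≡ true) (sym (∈-column⇒colOf≡ k T SYT-AtMostOnce m)) (≡ᵇ-refl k)))
      (λ e m → let (a , b) = ∈-filterᵇ⁻ _ (range1 n) m in
               colOf≡⇒∈-column k T SYT-AtMostOnce (∈-resp-↭ (↭-sym entries) a) (≡ᵇ≡true⇒≡ _ _ b))

    count≤-column : ∀ k i → i ≤ n → count (λ x → x ≤ᵇ i) (column k T) ≡ countUpTo (inColumn T k) i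
    count≤-column k i i≤n = begin
      count (λ x → x ≤ᵇ i) (column k T)                           ≡⟨ cong (count (λ x → x ≤ᵇ i)) (SYT-column k) ⟩
      count (λ x → x ≤ᵇ i) (filterᵇ (inColumn T k) (range1 n))    ≡⟨ count-filterᵇ (inColumn T k) (λ x → x ≤ᵇ i) (range1 n) ⟩
      count (λ x → inColumn T k x ∧ (x ≤ᵇ i)) (range1 n)          ≡⟨ countUpTo-prefix (inColumn T k) i n i≤n ⟩
      countUpTo (inColumn T k) i                                   ∎
      where open ≡-Reasoning

    col-restrict : ∀ k i → i ≤ n → col (suc k) (restrict i T) ≡ countUpTo (inColumn T k) i
    col-restrict k i i≤n = begin
      length (column k (restrict i T))  ≡⟨ cong length (column-restrict i k T rowsIncr) ⟩
      length (atMost i (column k T))    ≡⟨ length-filterᵇ (λ x → x ≤ᵇ i) (column k T) ⟩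
      count (λ x → x ≤ᵇ i) (column k T) ≡⟨ count≤-column k i i≤n ⟩
      countUpTo (inColumn T k) i        ∎
      where open ≡-Reasoning

    countUpTo-inColumn-dominance : ∀ j m → suc m ≤ n →
                                   countUpTo (inColumn T (suc j)) (suc m) ≤ countUpTo (inColumn T j) m
    countUpTo-inColumn-dominance j m le = subst₂ _≤_ (count≤-column (suc j) (suc m) le)
      (trans (count-cong _ _ (column j T) (λ x _ → <ᵇ-suc x m)) (count≤-column j m (≤-trans (n≤1+n m) le)))
      (column-dominance T rowsIncr j (suc m))

  blocksOf : ℕ → (ℕ → ℕ) → Array
  blocksOf n f = map (λ i → filterᵇ (λ e → f e ≡ᵇ i) (range1 n)) (upTo (suc n))

  -- The column rearrangement local to φ, verbatim, so that φ≡Φ holds by unfolding φ.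
  rearrangeColumns : Array → Array
  rearrangeColumns A = map (λ j → map (λ k → nth (sortℕ (column k A)) j) (upTo (length (rowAt A j)))) (upTo (length A))

  Φ : ℕ → (ℕ → ℕ) → Array
  Φ n f = rearrangeColumns (sortRowsByLength (filterᵇ isNonEmpty (blocksOf n f)))

  -- Off [1, n] the junk value suc n is returned, which is no block index.
  blockIndex : ∀ {n} → WeakPartition n → ℕ → ℕ
  blockIndex {n} p zero    = suc n
  blockIndex {n} p (suc j) with j <? n
  ... | yes j<n = toℕ (lookup p (fromℕ< j<n))
  ... | no _    = suc n

  blockIndex≤ : ∀ {n} (p : WeakPartition n) e → 1 ≤ e → e ≤ n → blockIndex p e ≤ n
  blockIndex≤ {n} p (suc j) _ le with j <? n
  ... | yes j<n = ≤-pred (toℕ<n (lookup p (fromℕ< j<n)))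
  ... | no j≮n  = ⊥-elim (j≮n le)

  private
    -- `block p i` filters with a predicate local to Defs; unification recovers it.
    filterPredicate : ∀ {xs ys : List ℕ} {P : ℕ → Bool} → ys ≡ filterᵇ P xs → ℕ → Bool
    filterPredicate {P = P} _ = P

    inBlock : ∀ {n} (p : WeakPartition n) (i : ℕ) → ℕ → Bool
    inBlock {n} p i = filterPredicate {xs = range1 n} {ys = block p i} refl

    inBlock≡ : ∀ {n} (p : WeakPartition n) i e → i ≤ n → inBlock p i e ≡ (blockIndex p e ≡ᵇ i)
    inBlock≡ {n} p i zero    le = sym (≢⇒≡ᵇ≡false (suc n) i (λ e → <-irrefl (sym e) (s≤s le)))
    inBlock≡ {n} p i (suc j) le with j <? n
    ... | yes j<n = refl
    ... | no _    = sym (≢⇒≡ᵇ≡false (suc n) i (λ e → <-irrefl (sym e) (s≤s le)))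

  block≡ : ∀ {n} (p : WeakPartition n) i → i ≤ n → block p i ≡ filterᵇ (λ e → blockIndex p e ≡ᵇ i) (range1 n)
  block≡ {n} p i le = filterᵇ-cong (inBlock p i) _ (range1 n) (λ e _ → inBlock≡ p i e le)

  φ≡Φ : ∀ {n} (p : WeakPartition n) → φ p ≡ Φ n (blockIndex p)
  φ≡Φ {n} p = cong (λ X → rearrangeColumns (sortRowsByLength (filterᵇ isNonEmpty X))) (blocks≡ (upTo (suc n)) ∈-upTo⁻)
    where
    blocks≡ : ∀ is → (∀ {i} → i ∈ is → i < suc n) → map (block p) is ≡ map (λ i → filterᵇ (λ e → blockIndex p e ≡ᵇ i) (range1 n)) is
    blocks≡ []       h = refl
    blocks≡ (i ∷ is) h = cong₂ _∷_ (block≡ p i (≤-pred (h (here refl)))) (blocks≡ is (h ∘ there))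

  module BlockTableau (n : ℕ) (f : ℕ → ℕ) (f≤n : ∀ e → 1 ≤ e → e ≤ n → f e ≤ n) where

    B : ℕ → List ℕ
    B i = filterᵇ (λ e → f e ≡ᵇ i) (range1 n)

    blocks : Array
    blocks = blocksOf n f

    nonEmptyBlocks : Array
    nonEmptyBlocks = filterᵇ isNonEmpty blocks

    sortedBlocks : Array
    sortedBlocks = sortRowsByLength nonEmptyBlocks

    rowCount : ℕ
    rowCount = length sortedBlocks

    rowLength : ℕ → ℕ
    rowLength j = length (rowAt sortedBlocks j)

    sortedColumn : ℕ → List ℕ
    sortedColumn k = sortℕ (column k sortedBlocks)

    rank : ℕ → ℕ
    rank e = countUpTo (λ x → f x ≡ᵇ f e) (pred e)

    Increasing-B : ∀ i → Increasing (B i)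
    Increasing-B i = Increasing-filterᵇ _ (Increasing-range1 n)

    ∈-B⁻ : ∀ i {e} → e ∈ B i → e ∈ range1 n × f e ≡ i
    ∈-B⁻ i m = let (a , b) = ∈-filterᵇ⁻ _ (range1 n) m in a , ≡ᵇ≡true⇒≡ _ _ b

    ∈-B⁺ : ∀ {e} → e ∈ range1 n → e ∈ B (f e)
    ∈-B⁺ {e} m = ∈-filterᵇ⁺ _ (range1 n) m (≡ᵇ-refl (f e))

    length-B≤ : ∀ i → length (B i) ≤ n
    length-B≤ i = begin
      length (B i)                        ≡⟨ length-filterᵇ _ (range1 n) ⟩
      count (λ e → f e ≡ᵇ i) (range1 n)   ≤⟨ count≤length _ (range1 n) ⟩
      length (range1 n)                   ≡⟨ length-applyUpTo suc n ⟩
      n                                   ∎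
      where open ≤-Reasoning

    B-index≤n : ∀ {e} → e ∈ range1 n → f e ∈ upTo (suc n)
    B-index≤n m = ∈-upTo⁺ (s≤s (f≤n _ (proj₁ (∈-range1⁻ m)) (proj₂ (∈-range1⁻ m))))

    ∈-sortedBlocks⁻ : ∀ {r} → r ∈ sortedBlocks → (∃ λ i → r ≡ B i) × NonEmptyRow r
    ∈-sortedBlocks⁻ m with ∈-filterᵇ-isNonEmpty⁻ blocks (∈-resp-↭ (sortRowsByLength-↭ nonEmptyBlocks) m)
    ... | mb , ne with ∈-map⁻ B mb
    ...   | i , _ , e = (i , e) , ne

    sortedBlocks-Increasing : All Increasing sortedBlocks
    sortedBlocks-Increasing = All.tabulate (λ m → let ((i , e) , _) = ∈-sortedBlocks⁻ m in subst Increasing (sym e) (Increasing-B i))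

    sortedBlocks-NonEmpty : All NonEmptyRow sortedBlocks
    sortedBlocks-NonEmpty = All.tabulate (λ m → proj₂ (∈-sortedBlocks⁻ m))

    length-sortedBlocks≤ : ∀ {r} → r ∈ sortedBlocks → length r ≤ n
    length-sortedBlocks≤ m = let ((i , e) , _) = ∈-sortedBlocks⁻ m in subst (λ z → length z ≤ n) (sym e) (length-B≤ i)

    rowLength-Decreasing : Decreasing rowLength
    rowLength-Decreasing = LengthsDecreasing⇒Decreasing sortedBlocks (sortRowsByLength-sorted nonEmptyBlocks)

    count<-B≡rank : ∀ {e} → e ∈ range1 n → count (λ x → x <ᵇ e) (B (f e)) ≡ rank e
    count<-B≡rank {zero}  m with () ← proj₁ (∈-range1⁻ m)
    count<-B≡rank {suc j} m = begin
      count (λ x → x <ᵇ suc j) (B (f (suc j)))                   ≡⟨ count-filterᵇ _ _ (range1 n) ⟩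
      count (λ x → (f x ≡ᵇ f (suc j)) ∧ (x <ᵇ suc j)) (range1 n)
        ≡⟨ count-cong _ _ (range1 n) (λ x _ → cong ((f x ≡ᵇ f (suc j)) ∧_) (<ᵇ-suc x j)) ⟩
      count (λ x → (f x ≡ᵇ f (suc j)) ∧ (x ≤ᵇ j)) (range1 n)
        ≡⟨ countUpTo-prefix (λ x → f x ≡ᵇ f (suc j)) j n (<⇒≤ (proj₂ (∈-range1⁻ m))) ⟩
      rank (suc j)                                               ∎
      where open ≡-Reasoning

    -- Sorting the rows by length moves no entry to another column.
    ∈-column-rank : ∀ {e} → e ∈ range1 n → e ∈ column (rank e) sortedBlocks
    ∈-column-rank {e} m = ∈-resp-↭ (↭-sym (column-↭ (rank e) (sortRowsByLength-↭ nonEmptyBlocks)))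
      (subst (e ∈_) (sym (column-filterᵇ-isNonEmpty (rank e) blocks))
        (∈-column⁺ (rank e) blocks (∈-map⁺ B (B-index≤n m))
          (subst (λ k → nth? (B (f e)) k ≡ just e) (count<-B≡rank m) (nth?-Increasing⁺ (B (f e)) (Increasing-B (f e)) (∈-B⁺ m)))))

    occ-B≤ : ∀ e i → occ e (B i) ≤ fromBool (f e ≡ᵇ i)
    occ-B≤ e i with f e ≡ᵇ i in eq
    ... | true  = Increasing⇒AtMostOnce (Increasing-B i) e
    ... | false = ≤-reflexive (∉⇒occ≡0 (B i) (λ m → true≢false (trans (cong (_≡ᵇ i) (proj₂ (∈-B⁻ i {e} m))) (≡ᵇ-refl i)) eq))

    occ-concat-B≤ : ∀ e is → occ e (concat (map B is)) ≤ occ (f e) is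
    occ-concat-B≤ e []       = z≤n
    occ-concat-B≤ e (i ∷ is) rewrite count-++ (e ≡ᵇ_) (B i) (concat (map B is)) = +-mono-≤ (occ-B≤ e i) (occ-concat-B≤ e is)

    blocks-AtMostOnce : AtMostOnce (concat blocks)
    blocks-AtMostOnce e = ≤-trans (occ-concat-B≤ e (upTo (suc n))) (Increasing⇒AtMostOnce (Increasing-upTo (suc n)) (f e))

    ∈-concat-blocks⁻ : ∀ z → z ∈ concat blocks → z ∈ range1 n
    ∈-concat-blocks⁻ z m with ∈-concat⁻′ blocks m
    ... | r , z∈r , mr with ∈-map⁻ B mr
    ...   | i , _ , refl = proj₁ (∈-B⁻ i z∈r)

    ∈-concat-blocks⁺ : ∀ z → z ∈ range1 n → z ∈ concat blocks
    ∈-concat-blocks⁺ z m = ∈-concat⁺′ (∈-B⁺ m) (∈-map⁺ B (B-index≤n m))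

    occ-sortedBlocks : ∀ e → occ e (concat sortedBlocks) ≡ occ e (range1 n)
    occ-sortedBlocks e = begin
      occ e (concat sortedBlocks)   ≡⟨ count-concat-↭ (e ≡ᵇ_) (sortRowsByLength-↭ nonEmptyBlocks) ⟩
      occ e (concat nonEmptyBlocks) ≡⟨ count-concat-filterᵇ-isNonEmpty (e ≡ᵇ_) blocks ⟩
      occ e (concat blocks)         ≡⟨ sameElements⇒occ≡ e (concat blocks) (range1 n) blocks-AtMostOnce
                                         (Increasing⇒AtMostOnce (Increasing-range1 n)) ∈-concat-blocks⁻ ∈-concat-blocks⁺ ⟩
      occ e (range1 n)              ∎
      where open ≡-Reasoning

    sortedColumn-↭ : ∀ k → sortedColumn k ↭ column k sortedBlocks
    sortedColumn-↭ k = sortℕ-↭ (column k sortedBlocks)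

    sortedColumn-Increasing : ∀ k → Increasing (sortedColumn k)
    sortedColumn-Increasing k = Sorted≤∧AtMostOnce⇒Increasing (sortℕ-sorted (column k sortedBlocks)) once
      where
      once : AtMostOnce (sortedColumn k)
      once e = begin
        occ e (sortedColumn k)           ≡⟨ count-↭ (e ≡ᵇ_) (sortedColumn-↭ k) ⟩
        occ e (column k sortedBlocks)    ≤⟨ occ-column≤occ-concat e k sortedBlocks ⟩
        occ e (concat sortedBlocks)      ≡⟨ occ-sortedBlocks e ⟩
        occ e (range1 n)                 ≤⟨ Increasing⇒AtMostOnce (Increasing-range1 n) e ⟩
        1                                ∎
        where open ≤-Reasoning

    length-sortedColumn : ∀ k → length (sortedColumn k) ≡ countBelow (λ j → k <ᵇ rowLength j) rowCount
    length-sortedColumn k = trans (↭-length (sortedColumn-↭ k)) (length-column k sortedBlocks)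

    row : ℕ → List ℕ
    row j = applyUpTo (λ k → nth (sortedColumn k) j) (rowLength j)

    tableau : Array
    tableau = applyUpTo row rowCount

    Φ≡tableau : Φ n f ≡ tableau
    Φ≡tableau = trans (map-upTo _ rowCount) (applyUpTo-cong _ _ rowCount (λ j _ → map-upTo _ (rowLength j)))

    length-row : ∀ j → length (row j) ≡ rowLength j
    length-row j = length-applyUpTo _ (rowLength j)

    column-tableau : ∀ k → column k tableau ≡ sortedColumn k
    column-tableau k = begin
      column k tableau
        ≡⟨ column-applyUpTo row rowCount k row-Decreasing ⟩
      applyUpTo (λ j → nth (row j) k) (countBelow (λ j → k <ᵇ length (row j)) rowCount)
        ≡⟨ cong (applyUpTo (λ j → nth (row j) k)) (countBelow-cong _ _ rowCount (cong (k <ᵇ_) ∘ length-row)) ⟩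
      applyUpTo (λ j → nth (row j) k) (countBelow (λ j → k <ᵇ rowLength j) rowCount)
        ≡⟨ applyUpTo-cong _ _ _ entry ⟩
      applyUpTo (nth (sortedColumn k)) (countBelow (λ j → k <ᵇ rowLength j) rowCount)
        ≡⟨ cong (applyUpTo (nth (sortedColumn k))) (length-sortedColumn k) ⟨
      applyUpTo (nth (sortedColumn k)) (length (sortedColumn k))
        ≡⟨ applyUpTo-nth (sortedColumn k) ⟩
      sortedColumn k ∎
      where
      open ≡-Reasoning
      row-Decreasing : Decreasing (length ∘ row)
      row-Decreasing j = subst₂ _≤_ (sym (length-row (suc j))) (sym (length-row j)) (rowLength-Decreasing j)
      entry : ∀ j → j < countBelow (λ j → k <ᵇ rowLength j) rowCount → nth (row j) k ≡ nth (sortedColumn k) j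
      entry j lt = nth-applyUpTo (λ k → nth (sortedColumn k) j) (rowLength j) k (<countBelow⇒< rowLength k rowCount rowLength-Decreasing j lt)

    rowLength-pos : ∀ j → j < rowCount → 1 ≤ rowLength j
    rowLength-pos j lt with rowAt sortedBlocks j | All.lookup sortedBlocks-NonEmpty (rowAt-∈ sortedBlocks j lt)
    ... | _ | nonEmpty = s≤s z≤n

    <length-sortedColumn : ∀ k j → j < rowCount → k < rowLength j → j < length (sortedColumn k)
    <length-sortedColumn k j jN kL = subst (j <_) (sym (length-sortedColumn k)) (<⇒<countBelow rowLength k rowCount rowLength-Decreasing j jN kL)

    tableau-NonEmpty : All NonEmptyRow tableau
    tableau-NonEmpty = AllP.applyUpTo⁺₁ row rowCount (λ lt → nonEmpty-applyUpTo (rowLength-pos _ lt))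
      where
      nonEmpty-applyUpTo : ∀ {l} {g : ℕ → ℕ} → 1 ≤ l → NonEmptyRow (applyUpTo g l)
      nonEmpty-applyUpTo {suc l} _ = nonEmpty

    -- Adjacent sorted columns are again dominated, since the rows of sortedBlocks increase.
    tableau-rowsIncreasing : All Increasing tableau
    tableau-rowsIncreasing = AllP.applyUpTo⁺₁ row rowCount (λ {j} jN → Linked.applyUpTo⁺₁ _ (rowLength j) (λ {k} lt →
      dominance⇒nth< (sortedColumn k) (sortedColumn (suc k)) (sortedColumn-Increasing k) (sortedColumn-Increasing (suc k))
        (λ t → subst₂ _≤_ (sym (count-↭ _ (sortedColumn-↭ (suc k)))) (sym (count-↭ _ (sortedColumn-↭ k)))
                          (column-dominance sortedBlocks sortedBlocks-Increasing k t))
        j (<length-sortedColumn (suc k) j jN lt)))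

    tableau-columnsIncreasing : Linked Above tableau
    tableau-columnsIncreasing = Linked.applyUpTo⁺₁ row rowCount (λ {j} lt →
      Above-applyUpTo _ _ (rowLength j) (rowLength (suc j)) (rowLength-Decreasing j)
        (λ k kl → nth-<-suc (sortedColumn k) j (sortedColumn-Increasing k) (<length-sortedColumn k (suc j) lt kl)))

    length-tableau-row≤ : ∀ {r} → r ∈ tableau → length r ≤ n
    length-tableau-row≤ m with ∈-applyUpTo⁻ row m
    ... | j , _ , refl = subst (_≤ n) (sym (length-row j)) (length-rowAt≤ sortedBlocks n length-sortedBlocks≤ j)

    -- Columns are permutations of those of sortedBlocks, so the entries are too.
    occ-tableau : ∀ e → occ e (concat tableau) ≡ occ e (range1 n)
    occ-tableau e = begin
      occ e (concat tableau)
        ≡⟨ count-concat-by-columns (e ≡ᵇ_) tableau (suc n) (λ m → ≤-trans (length-tableau-row≤ m) (n≤1+n n)) ⟩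
      sumBelow (λ k → occ e (column k tableau)) (suc n)
        ≡⟨ sumBelow-cong _ _ (suc n) (λ k _ → trans (cong (occ e) (column-tableau k)) (count-↭ (e ≡ᵇ_) (sortedColumn-↭ k))) ⟩
      sumBelow (λ k → occ e (column k sortedBlocks)) (suc n)
        ≡⟨ count-concat-by-columns (e ≡ᵇ_) sortedBlocks (suc n) (λ m → ≤-trans (length-sortedBlocks≤ m) (n≤1+n n)) ⟨
      occ e (concat sortedBlocks)
        ≡⟨ occ-sortedBlocks e ⟩
      occ e (range1 n) ∎
      where open ≡-Reasoning

    tableau-IsSYT : IsSYT n tableau
    tableau-IsSYT = record
      { rowsNonEmpty = tableau-NonEmpty
      ; rowsIncr     = tableau-rowsIncreasing
      ; colsIncr     = tableau-columnsIncreasing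
      ; entries      = occ≗⇒↭ _ _ occ-tableau
      }

    colOf-tableau : ∀ {e} → e ∈ range1 n → colOf e tableau ≡ rank e
    colOf-tableau {e} m = ∈-column⇒colOf≡ (rank e) tableau (SYT-AtMostOnce tableau-IsSYT)
      (subst (e ∈_) (sym (column-tableau (rank e))) (∈-resp-↭ (↭-sym (sortedColumn-↭ (rank e))) (∈-column-rank m)))

    Φ-IsSYT : IsSYT n (Φ n f)
    Φ-IsSYT = subst (IsSYT n) (sym Φ≡tableau) tableau-IsSYT

    Φ≡⇒rank≡colOf : ∀ T → Φ n f ≡ T → ∀ {e} → e ∈ range1 n → rank e ≡ colOf e T
    Φ≡⇒rank≡colOf T eq {e} m = trans (sym (colOf-tableau m)) (cong (colOf e) (trans (sym Φ≡tableau) eq))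

    rank≡colOf⇒Φ≡ : ∀ T → IsSYT n T → (∀ {e} → e ∈ range1 n → rank e ≡ colOf e T) → Φ n f ≡ T
    rank≡colOf⇒Φ≡ T ST h = trans Φ≡tableau (≡-by-columns tableau T tableau-NonEmpty (IsSYT.rowsNonEmpty ST)
      tableau-columnsIncreasing (IsSYT.colsIncr ST) (λ k → begin
        column k tableau                                 ≡⟨ SYT-column tableau-IsSYT k ⟩
        filterᵇ (inColumn tableau k) (range1 n)          ≡⟨ filterᵇ-cong _ _ (range1 n) (λ e m → cong (_≡ᵇ k) (trans (colOf-tableau m) (h m))) ⟩
        filterᵇ (inColumn T k) (range1 n)                ≡⟨ SYT-column ST k ⟨
        column k T                                       ∎))
      where open ≡-Reasoning

    count-length-applyUpTo : ∀ (P : ℕ → Bool) (X : Array) (H : ℕ → List ℕ) → (∀ j → length (H j) ≡ length (rowAt X j)) →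
                             count (P ∘ length) (applyUpTo H (length X)) ≡ count (P ∘ length) X
    count-length-applyUpTo P []      H h = refl
    count-length-applyUpTo P (r ∷ X) H h = cong₂ _+_ (cong (fromBool ∘ P) (h 0)) (count-length-applyUpTo P X (H ∘ suc) (h ∘ suc))

    count-length-filterᵇ-isNonEmpty : ∀ (P : ℕ → Bool) → P 0 ≡ false → ∀ X →
                                      count (P ∘ length) (filterᵇ isNonEmpty X) ≡ count (P ∘ length) X
    count-length-filterᵇ-isNonEmpty P p0 []            = refl
    count-length-filterᵇ-isNonEmpty P p0 ([] ∷ X)      rewrite p0 = count-length-filterᵇ-isNonEmpty P p0 X
    count-length-filterᵇ-isNonEmpty P p0 ((x ∷ r) ∷ X) = cong (fromBool (P (suc (length r))) +_) (count-length-filterᵇ-isNonEmpty P p0 X)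

    rowsOfLength-Φ : ∀ i → 1 ≤ i → rowsOfLength i (Φ n f) ≡ count (λ r → length r ≡ᵇ i) blocks
    rowsOfLength-Φ (suc i) _ = begin
      rowsOfLength (suc i) (Φ n f)                      ≡⟨ cong (rowsOfLength (suc i)) Φ≡tableau ⟩
      length (filterᵇ (λ r → length r ≡ᵇ suc i) tableau) ≡⟨ length-filterᵇ _ tableau ⟩
      count (λ r → length r ≡ᵇ suc i) tableau           ≡⟨ count-length-applyUpTo (_≡ᵇ suc i) sortedBlocks row length-row ⟩
      count (λ r → length r ≡ᵇ suc i) sortedBlocks      ≡⟨ count-↭ _ (sortRowsByLength-↭ nonEmptyBlocks) ⟩
      count (λ r → length r ≡ᵇ suc i) nonEmptyBlocks    ≡⟨ count-length-filterᵇ-isNonEmpty (_≡ᵇ suc i) refl blocks ⟩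
      count (λ r → length r ≡ᵇ suc i) blocks            ∎
      where open ≡-Reasoning

    numRows-Φ : numRows (Φ n f) ≡ count isNonEmpty blocks
    numRows-Φ = begin
      length (Φ n f)          ≡⟨ cong length Φ≡tableau ⟩
      length tableau          ≡⟨ length-applyUpTo row rowCount ⟩
      length sortedBlocks     ≡⟨ ↭-length (sortRowsByLength-↭ nonEmptyBlocks) ⟩
      length nonEmptyBlocks   ≡⟨ length-filterᵇ isNonEmpty blocks ⟩
      count isNonEmpty blocks ∎
      where open ≡-Reasoning

module Assignments where

  open Counting
  open Arrays
  open Tableaux
  open import Data.Nat using (zero; suc; pred; _+_; _*_; _<_; _∸_; z≤n; s≤s; _≡ᵇ_; _<ᵇ_; _≟_; _<?_)
  open import Data.Nat.Properties
  open import Algebra.Properties.CommutativeSemigroup +-commutativeSemigroup using (x∙yz≈y∙xz)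
  open import Data.Nat.ListAction using (product)
  open import Data.Nat.ListAction.Properties using (product-++)
  open import Data.Bool using (Bool; true; false; if_then_else_; T?)
  open import Data.Fin using (Fin; toℕ; fromℕ<) renaming (zero to fzero)
  open import Data.Fin.Properties using (toℕ<n; fromℕ<-toℕ; toℕ-fromℕ<)
  open import Data.Vec using (lookup; tabulate)
  open import Data.Vec.Properties using (lookup∘tabulate; tabulate∘lookup; tabulate-cong)
  open import Data.List using ([]; _∷_; filterᵇ; concatMap; _++_; applyUpTo; upTo)
  open import Data.List.Properties using (length-applyUpTo; length-map; length-++; map-++; map-∘; map-upTo)
  open import Data.List.Relation.Unary.All as All using (All; []; _∷_)
  import Data.List.Relation.Unary.All.Properties as AllP
  open import Data.List.Relation.Unary.AllPairs as AllPairs using ([]; _∷_)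
  import Data.List.Relation.Unary.AllPairs.Properties as AllPairs
  open import Data.List.Relation.Unary.Any using (here; there)
  open import Data.List.Relation.Unary.Unique.Propositional.Properties using (concat⁺; filter⁺; upTo⁺) renaming (map⁺ to Unique-map⁺)
  open import Data.List.Relation.Binary.Disjoint.Propositional using (Disjoint)
  open import Data.List.Relation.Binary.Permutation.Propositional using (_↭_)
  open import Data.List.Membership.Propositional.Properties
    using (∈-map⁺; ∈-map⁻; ∈-upTo⁺; ∈-upTo⁻; ∈-concat⁺′; ∈-concat⁻′; ∈-applyUpTo⁻)
  open import Data.Product using (proj₁; proj₂; ∃)
  open import Data.Empty using (⊥-elim)
  open import Data.Unit using (⊤; tt)
  open import Function using (_∘_)
  open import Function.Bundles using (Equivalence)
  open import Relation.Nullary using (¬_; yes; no)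
  open import Relation.Binary.PropositionalEquality

  -- An assignment of blocks to the elements 1, …, m is listed newest first, as [a_m, …, a_1].
  blockAt : List ℕ → ℕ → ℕ
  blockAt []      e = 0
  blockAt (a ∷ r) e = if e ≡ᵇ suc (length r) then a else blockAt r e

  blockAt-new : ∀ a r → blockAt (a ∷ r) (suc (length r)) ≡ a
  blockAt-new a r rewrite ≡ᵇ-refl (length r) = refl

  blockAt-old : ∀ a r e → e ≤ length r → blockAt (a ∷ r) e ≡ blockAt r e
  blockAt-old a r e le rewrite ≢⇒≡ᵇ≡false e (suc (length r)) (λ eq → <-irrefl eq (s≤s le)) = refl

  ≡-by-blockAt : ∀ r r′ → length r ≡ length r′ → (∀ e → 1 ≤ e → e ≤ length r → blockAt r e ≡ blockAt r′ e) → r ≡ r′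
  ≡-by-blockAt []      []       _  _ = refl
  ≡-by-blockAt (a ∷ r) (b ∷ r′) eq h = cong₂ _∷_ new (≡-by-blockAt r r′ eq′ old)
    where
    eq′ = suc-injective eq
    new : a ≡ b
    new = begin
      a                                 ≡⟨ blockAt-new a r ⟨
      blockAt (a ∷ r) (suc (length r))  ≡⟨ h (suc (length r)) (s≤s z≤n) ≤-refl ⟩
      blockAt (b ∷ r′) (suc (length r)) ≡⟨ cong (λ z → blockAt (b ∷ r′) (suc z)) eq′ ⟩
      blockAt (b ∷ r′) (suc (length r′)) ≡⟨ blockAt-new b r′ ⟩
      b                                 ∎
      where open ≡-Reasoning
    old : ∀ e → 1 ≤ e → e ≤ length r → blockAt r e ≡ blockAt r′ e
    old e l₁ l₂ = trans (sym (blockAt-old a r e l₂))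
                    (trans (h e l₁ (≤-trans l₂ (n≤1+n _))) (blockAt-old b r′ e (subst (e ≤_) eq′ l₂)))

  countUpTo-blockAt-∷ : ∀ a r (P : ℕ → Bool) j → j ≤ length r →
                        countUpTo (P ∘ blockAt (a ∷ r)) j ≡ countUpTo (P ∘ blockAt r) j
  countUpTo-blockAt-∷ a r P j le = countUpTo-cong _ _ j (λ e _ l₂ → cong P (blockAt-old a r e (≤-trans l₂ le)))

  occ≡countUpTo-blockAt : ∀ a r → occ a r ≡ countUpTo (λ x → blockAt r x ≡ᵇ a) (length r)
  occ≡countUpTo-blockAt a []      = refl
  occ≡countUpTo-blockAt a (b ∷ r) = sym (begin
    countUpTo (λ x → blockAt (b ∷ r) x ≡ᵇ a) (suc (length r))
      ≡⟨ countUpTo-suc _ (length r) ⟩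
    countUpTo (λ x → blockAt (b ∷ r) x ≡ᵇ a) (length r) + fromBool (blockAt (b ∷ r) (suc (length r)) ≡ᵇ a)
      ≡⟨ cong₂ _+_ (countUpTo-blockAt-∷ b r (_≡ᵇ a) (length r) ≤-refl) (cong (λ z → fromBool (z ≡ᵇ a)) (blockAt-new b r)) ⟩
    countUpTo (λ x → blockAt r x ≡ᵇ a) (length r) + fromBool (b ≡ᵇ a)
      ≡⟨ +-comm _ (fromBool (b ≡ᵇ a)) ⟩
    fromBool (b ≡ᵇ a) + countUpTo (λ x → blockAt r x ≡ᵇ a) (length r)
      ≡⟨ cong₂ _+_ (cong fromBool (≡ᵇ-sym b a)) (sym (occ≡countUpTo-blockAt a r)) ⟩
    occ a (b ∷ r) ∎)
    where open ≡-Reasoning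

  clamp : (n : ℕ) → ℕ → Fin (suc n)
  clamp n x with x <? suc n
  ... | yes lt = fromℕ< lt
  ... | no _   = fzero

  toℕ-clamp : ∀ n x → x ≤ n → toℕ (clamp n x) ≡ x
  toℕ-clamp n x le with x <? suc n
  ... | yes lt = toℕ-fromℕ< lt
  ... | no x≮  = ⊥-elim (x≮ (s≤s le))

  clamp-toℕ : ∀ n (i : Fin (suc n)) → clamp n (toℕ i) ≡ i
  clamp-toℕ n i with toℕ i <? suc n
  ... | yes lt = fromℕ<-toℕ i lt
  ... | no i≮  = ⊥-elim (i≮ (toℕ<n i))

  toWeakPartition : (n : ℕ) → List ℕ → WeakPartition n
  toWeakPartition n r = tabulate (λ j → clamp n (blockAt r (suc (toℕ j))))

  blockIndex-toWeakPartition : ∀ n r e → 1 ≤ e → e ≤ n → blockAt r e ≤ n → blockIndex (toWeakPartition n r) e ≡ blockAt r e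
  blockIndex-toWeakPartition n r (suc j) _ le h with j <? n
  ... | yes j<n rewrite lookup∘tabulate (λ j → clamp n (blockAt r (suc (toℕ j)))) (fromℕ< j<n) | toℕ-fromℕ< j<n = toℕ-clamp n _ h
  ... | no j≮n  = ⊥-elim (j≮n le)

  assignmentOf : ∀ {n} → WeakPartition n → ℕ → List ℕ
  assignmentOf p zero    = []
  assignmentOf p (suc m) = blockIndex p (suc m) ∷ assignmentOf p m

  length-assignmentOf : ∀ {n} (p : WeakPartition n) m → length (assignmentOf p m) ≡ m
  length-assignmentOf p zero    = refl
  length-assignmentOf p (suc m) = cong suc (length-assignmentOf p m)

  blockAt-assignmentOf : ∀ {n} (p : WeakPartition n) m e → 1 ≤ e → e ≤ m → blockAt (assignmentOf p m) e ≡ blockIndex p e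
  blockAt-assignmentOf p zero    (suc e) l₁ ()
  blockAt-assignmentOf p (suc m) e l₁ le with e ≟ suc m
  ... | yes refl = trans (cong (blockAt (assignmentOf p (suc m)) ∘ suc) (sym (length-assignmentOf p m))) (blockAt-new _ (assignmentOf p m))
  ... | no e≢ = trans (blockAt-old _ (assignmentOf p m) e (subst (e ≤_) (sym (length-assignmentOf p m)) e≤m))
                      (blockAt-assignmentOf p m e l₁ e≤m)
    where e≤m = ≤-pred (≤∧≢⇒< le e≢)

  toWeakPartition-assignmentOf : ∀ {n} (p : WeakPartition n) → toWeakPartition n (assignmentOf p n) ≡ p
  toWeakPartition-assignmentOf {n} p = trans (tabulate-cong pointwise) (tabulate∘lookup p)
    where
    pointwise : ∀ (i : Fin n) → clamp n (blockAt (assignmentOf p n) (suc (toℕ i))) ≡ lookup p i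
    pointwise i rewrite blockAt-assignmentOf p n (suc (toℕ i)) (s≤s z≤n) (toℕ<n i) with toℕ i <? n
    ... | yes lt = trans (cong (clamp n ∘ toℕ ∘ lookup p) (fromℕ<-toℕ i lt)) (clamp-toℕ n (lookup p i))
    ... | no i≮  = ⊥-elim (i≮ (toℕ<n i))

  IsOWP⇒blockIndex< : ∀ {n} (p : WeakPartition n) → IsOWP n p → ∀ e → 1 ≤ e → e ≤ n → blockIndex p e < e
  IsOWP⇒blockIndex< {n} p o e l₁ l₂ with blockIndex p e in eq
  ... | zero  = l₁
  ... | suc i = minimum< (subst (MinCondition (suc i)) (block≡ p (suc i) i≤n) (IsOWP.minCond o (suc i) (s≤s z≤n) i≤n))
                  (Increasing-filterᵇ _ (Increasing-range1 n))
                  (∈-filterᵇ⁺ _ (range1 n) (∈-range1⁺ l₁ l₂) (subst (λ z → (z ≡ᵇ suc i) ≡ true) (sym eq) (≡ᵇ-refl (suc i))))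
    where
    i≤n : suc i ≤ n
    i≤n = subst (_≤ n) eq (blockIndex≤ p e l₁ l₂)
    minimum< : ∀ {i xs e} → MinCondition i xs → Increasing xs → e ∈ xs → i < e
    minimum< {xs = x ∷ xs} i<x l m = <-≤-trans i<x (Increasing-head≤ l m)

  blockIndex<⇒IsOWP : ∀ {n} (p : WeakPartition n) → 1 ≤ n → (∀ e → 1 ≤ e → e ≤ n → blockIndex p e < e) → IsOWP n p
  blockIndex<⇒IsOWP {n} p 1≤n h = record { oneInB₀ = one∈B₀ ; minCond = minCond }
    where
    one∈B₀ : 1 ∈ block p 0
    one∈B₀ = subst (1 ∈_) (sym (block≡ p 0 z≤n)) (∈-filterᵇ⁺ _ (range1 n) (∈-range1⁺ ≤-refl 1≤n) (<1⇒≡ᵇ0 (h 1 ≤-refl 1≤n)))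
      where
      <1⇒≡ᵇ0 : ∀ {x} → x < 1 → (x ≡ᵇ 0) ≡ true
      <1⇒≡ᵇ0 {zero} _ = refl
      <1⇒≡ᵇ0 {suc _} (s≤s ())
    minimum : ∀ i xs → (∀ {x} → x ∈ xs → i < x) → MinCondition i xs
    minimum i []      _ = tt
    minimum i (x ∷ _) h = h (here refl)
    minCond : ∀ i → 1 ≤ i → i ≤ n → MinCondition i (block p i)
    minCond i l₁ l₂ = subst (MinCondition i) (sym (block≡ p i l₂)) (minimum i _ (λ {x} m →
      let (a , b) = ∈-filterᵇ⁻ _ (range1 n) m ; (c , d) = ∈-range1⁻ a in subst (_< x) (≡ᵇ≡true⇒≡ _ _ b) (h x c d)))

  -- `Q m a r` decides whether element m + 1 may join block a ∈ [0, m] after the assignment r of 1, …, m.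
  StepTest : Set
  StepTest = ℕ → ℕ → List ℕ → Bool

  extensions : StepTest → ℕ → List ℕ → List (List ℕ)
  extensions Q m r = map (_∷ r) (filterᵇ (λ a → Q m a r) (upTo (suc m)))

  assignments : StepTest → ℕ → List (List ℕ)
  assignments Q zero    = [] ∷ []
  assignments Q (suc m) = concatMap (extensions Q m) (assignments Q m)

  Valid : StepTest → List ℕ → Set
  Valid Q []      = ⊤
  Valid Q (a ∷ r) = a < suc (length r) × Q (length r) a r ≡ true × Valid Q r

  ∈-extensions⁻ : ∀ Q m r {s} → s ∈ extensions Q m r → ∃ λ a → s ≡ a ∷ r × a < suc m × Q m a r ≡ true
  ∈-extensions⁻ Q m r mem with ∈-map⁻ (_∷ r) mem
  ... | a , ma , refl = let (u , v) = ∈-filterᵇ⁻ (λ a → Q m a r) (upTo (suc m)) ma in a , refl , ∈-upTo⁻ u , v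

  ∈-extensions⁺ : ∀ Q m r a → a < suc m → Q m a r ≡ true → (a ∷ r) ∈ extensions Q m r
  ∈-extensions⁺ Q m r a lt q = ∈-map⁺ (_∷ r) (∈-filterᵇ⁺ (λ a → Q m a r) (upTo (suc m)) (∈-upTo⁺ lt) q)

  ∈-assignments⁻ : ∀ Q m {r} → r ∈ assignments Q m → length r ≡ m × Valid Q r
  ∈-assignments⁻ Q zero    (here refl) = refl , tt
  ∈-assignments⁻ Q (suc m) mem with ∈-concat⁻′ (map (extensions Q m) (assignments Q m)) mem
  ... | s , ms , mxs with ∈-map⁻ (extensions Q m) mxs
  ...   | r′ , mr′ , refl with ∈-extensions⁻ Q m r′ ms | ∈-assignments⁻ Q m mr′
  ...     | a , refl , lt , q | refl , v = refl , lt , q , v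

  ∈-assignments⁺ : ∀ Q m r → length r ≡ m → Valid Q r → r ∈ assignments Q m
  ∈-assignments⁺ Q zero    []      refl tt           = here refl
  ∈-assignments⁺ Q (suc m) (a ∷ r) refl (lt , q , v) =
    ∈-concat⁺′ (∈-extensions⁺ Q (length r) r a lt q) (∈-map⁺ (extensions Q (length r)) (∈-assignments⁺ Q (length r) r refl v))

  assignments-Unique : ∀ Q m → Unique (assignments Q m)
  assignments-Unique Q zero    = [] ∷ []
  assignments-Unique Q (suc m) =
    concat⁺ (AllP.map⁺ (All.tabulate (λ {r} _ → extensions-Unique r))) (AllPairs.map⁺ (AllPairs.map disjoint (assignments-Unique Q m)))
    where
    extensions-Unique : ∀ r → Unique (extensions Q m r)
    extensions-Unique r = Unique-map⁺ (λ { refl → refl }) (filter⁺ (λ a → T? (Q m a r)) (upTo⁺ (suc m)))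
    disjoint : ∀ {r r′} → ¬ r ≡ r′ → Disjoint (extensions Q m r) (extensions Q m r′)
    disjoint r≢r′ (m₁ , m₂) with ∈-extensions⁻ Q m _ m₁ | ∈-extensions⁻ Q m _ m₂
    ... | _ , refl , _ | _ , refl , _ = r≢r′ refl

  length-assignments-suc : ∀ Q m c → (∀ {r} → r ∈ assignments Q m → count (λ a → Q m a r) (upTo (suc m)) ≡ c) →
                           length (assignments Q (suc m)) ≡ length (assignments Q m) * c
  length-assignments-suc Q m c h = go (assignments Q m) h
    where
    go : ∀ rs → (∀ {r} → r ∈ rs → count (λ a → Q m a r) (upTo (suc m)) ≡ c) → length (concatMap (extensions Q m) rs) ≡ length rs * c
    go []       h = refl
    go (r ∷ rs) h = begin
      length (extensions Q m r ++ concatMap (extensions Q m) rs)       ≡⟨ length-++ (extensions Q m r) ⟩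
      length (extensions Q m r) + length (concatMap (extensions Q m) rs) ≡⟨ cong₂ _+_ choices (go rs (h ∘ there)) ⟩
      c + length rs * c                                                ∎
      where
      open ≡-Reasoning
      choices : length (extensions Q m r) ≡ c
      choices = trans (length-map (_∷ r) (filterᵇ (λ a → Q m a r) (upTo (suc m))))
                      (trans (length-filterᵇ (λ a → Q m a r) (upTo (suc m))) (h (here refl)))

  Valid⇒∈< : ∀ Q r → Valid Q r → ∀ {a} → a ∈ r → a < length r
  Valid⇒∈< Q (a ∷ r) (lt , _ , v) (here refl) = lt
  Valid⇒∈< Q (a ∷ r) (lt , _ , v) (there m)   = ≤-trans (Valid⇒∈< Q r v m) (n≤1+n _)

  Valid⇒blockAt< : ∀ Q r → Valid Q r → ∀ e → 1 ≤ e → e ≤ length r → blockAt r e < e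
  Valid⇒blockAt< Q []      _            (suc e) l₁ ()
  Valid⇒blockAt< Q (a ∷ r) (lt , _ , v) e l₁ l₂ with e ≟ suc (length r)
  ... | yes refl = subst (_< e) (sym (blockAt-new a r)) lt
  ... | no e≢    = subst (_< e) (sym (blockAt-old a r e e≤)) (Valid⇒blockAt< Q r v e l₁ e≤)
    where e≤ = ≤-pred (≤∧≢⇒< l₂ e≢)

  blockIndex-valid : ∀ Q n r → length r ≡ n → Valid Q r → ∀ e → 1 ≤ e → e ≤ n → blockIndex (toWeakPartition n r) e ≡ blockAt r e
  blockIndex-valid Q n r refl v e l₁ l₂ = blockIndex-toWeakPartition n r e l₁ l₂ (<⇒≤ (<-≤-trans (Valid⇒blockAt< Q r v e l₁ l₂) l₂))

  toWeakPartition-injective : ∀ Q n {r r′} → r ∈ assignments Q n → r′ ∈ assignments Q n →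
                              toWeakPartition n r ≡ toWeakPartition n r′ → r ≡ r′
  toWeakPartition-injective Q n {r} {r′} m m′ eq with ∈-assignments⁻ Q n m | ∈-assignments⁻ Q n m′
  ... | l , v | l′ , v′ = ≡-by-blockAt r r′ (trans l (sym l′)) (λ e l₁ l₂ → let e≤n = subst (e ≤_) l l₂ in begin
    blockAt r e                               ≡⟨ blockIndex-valid Q n r l v e l₁ e≤n ⟨
    blockIndex (toWeakPartition n r) e        ≡⟨ cong (λ p → blockIndex p e) eq ⟩
    blockIndex (toWeakPartition n r′) e       ≡⟨ blockIndex-valid Q n r′ l′ v′ e l₁ e≤n ⟩
    blockAt r′ e                              ∎)
    where open ≡-Reasoning

  anyBlock : StepTest
  anyBlock _ _ _ = true

  blockAt<⇒Valid-anyBlock : ∀ r → (∀ e → 1 ≤ e → e ≤ length r → blockAt r e < e) → Valid anyBlock r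
  blockAt<⇒Valid-anyBlock []      h = tt
  blockAt<⇒Valid-anyBlock (a ∷ r) h =
    subst (_< suc (length r)) (blockAt-new a r) (h (suc (length r)) (s≤s z≤n) ≤-refl) , refl ,
    blockAt<⇒Valid-anyBlock r (λ e l₁ l₂ → subst (_< e) (blockAt-old a r e l₂) (h e l₁ (≤-trans l₂ (n≤1+n _))))

  rankIn : List ℕ → ℕ → ℕ
  rankIn r e = countUpTo (λ x → blockAt r x ≡ᵇ blockAt r e) (pred e)

  rankIn-new : ∀ a r → rankIn (a ∷ r) (suc (length r)) ≡ occ a r
  rankIn-new a r rewrite blockAt-new a r = trans (countUpTo-blockAt-∷ a r (_≡ᵇ a) (length r) ≤-refl) (sym (occ≡countUpTo-blockAt a r))

  rankIn-old : ∀ a r e → e ≤ length r → rankIn (a ∷ r) e ≡ rankIn r e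
  rankIn-old a r e le rewrite blockAt-old a r e le = countUpTo-blockAt-∷ a r (_≡ᵇ blockAt r e) (pred e) (≤-trans pred[n]≤n le)

  fitsColumn : Array → StepTest
  fitsColumn T m a r = occ a r ≡ᵇ colOf (suc m) T

  Fits : Array → List ℕ → Set
  Fits T r = ∀ e → 1 ≤ e → e ≤ length r → blockAt r e < e × rankIn r e ≡ colOf e T

  Valid⇒Fits : ∀ T r → Valid (fitsColumn T) r → Fits T r
  Valid⇒Fits T r v e l₁ l₂ = Valid⇒blockAt< (fitsColumn T) r v e l₁ l₂ , rank≡ r v e l₁ l₂
    where
    rank≡ : ∀ r → Valid (fitsColumn T) r → ∀ e → 1 ≤ e → e ≤ length r → rankIn r e ≡ colOf e T
    rank≡ []      _           (suc e) l₁ ()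
    rank≡ (a ∷ r) (_ , q , v) e l₁ l₂ with e ≟ suc (length r)
    ... | yes refl = trans (rankIn-new a r) (≡ᵇ≡true⇒≡ _ _ q)
    ... | no e≢    = trans (rankIn-old a r e e≤) (rank≡ r v e l₁ e≤)
      where e≤ = ≤-pred (≤∧≢⇒< l₂ e≢)

  Fits⇒Valid : ∀ T r → Fits T r → Valid (fitsColumn T) r
  Fits⇒Valid T []      h = tt
  Fits⇒Valid T (a ∷ r) h with h (suc (length r)) (s≤s z≤n) ≤-refl
  ... | new< , new-rank =
    subst (_< suc (length r)) (blockAt-new a r) new< ,
    subst (λ z → (z ≡ᵇ colOf (suc (length r)) T) ≡ true) (trans (sym new-rank) (rankIn-new a r)) (≡ᵇ-refl (colOf (suc (length r)) T)) ,
    Fits⇒Valid T r (λ e l₁ l₂ → let (x , y) = h e l₁ (≤-trans l₂ (n≤1+n _)) in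
      subst (_< e) (blockAt-old a r e l₂) x , trans (sym (rankIn-old a r e l₂)) y)

  count-update : ∀ (P P′ : ℕ → Bool) a d xs → (∀ x → ¬ x ≡ a → P′ x ≡ P x) → fromBool (P′ a) ≡ fromBool (P a) + d →
                 count P′ xs ≡ count P xs + occ a xs * d
  count-update P P′ a d []       h ha = refl
  count-update P P′ a d (x ∷ xs) h ha with a ≡ᵇ x in eq
  ... | true rewrite sym (≡ᵇ≡true⇒≡ a x eq) | ha | count-update P P′ a d xs h ha =
    trans (+-assoc (fromBool (P a)) d _) (trans (cong (fromBool (P a) +_) (x∙yz≈y∙xz d (count P xs) _)) (sym (+-assoc (fromBool (P a)) _ _)))
  ... | false rewrite h x (λ e → true≢false (trans (cong (a ≡ᵇ_) e) (≡ᵇ-refl a)) eq) | count-update P P′ a d xs h ha =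
    sym (+-assoc (fromBool (P x)) _ _)

  fromBool-<ᵇ-suc : ∀ t c → fromBool (t <ᵇ suc c) ≡ fromBool (t <ᵇ c) + fromBool (c ≡ᵇ t)
  fromBool-<ᵇ-suc zero    zero    = refl
  fromBool-<ᵇ-suc zero    (suc c) = refl
  fromBool-<ᵇ-suc (suc t) zero    with t
  ... | zero  = refl
  ... | suc _ = refl
  fromBool-<ᵇ-suc (suc t) (suc c) = fromBool-<ᵇ-suc t c

  stepsAtRank : ℕ → List ℕ → ℕ
  stepsAtRank t []      = 0
  stepsAtRank t (a ∷ r) = fromBool (occ a r ≡ᵇ t) + stepsAtRank t r

  -- A block has more than t elements iff exactly one of its elements entered it at rank t.
  blocksAbove≡stepsAtRank : ∀ t B r → (∀ {a} → a ∈ r → a < B) → count (λ a → t <ᵇ occ a r) (upTo B) ≡ stepsAtRank t r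
  blocksAbove≡stepsAtRank t B []      h = none (upTo B)
    where
    none : ∀ xs → count (λ a → t <ᵇ 0) xs ≡ 0
    none []       = refl
    none (x ∷ xs) rewrite ≥⇒<ᵇ≡false t 0 z≤n = none xs
  blocksAbove≡stepsAtRank t B (a ∷ r) h = begin
    count (λ x → t <ᵇ occ x (a ∷ r)) (upTo B)              ≡⟨ count-update _ _ a δ (upTo B) unchanged grown ⟩
    count (λ x → t <ᵇ occ x r) (upTo B) + occ a (upTo B) * δ ≡⟨ cong₂ _+_ (blocksAbove≡stepsAtRank t B r (h ∘ there)) (cong (_* δ) a-once) ⟩
    stepsAtRank t r + (δ + 0)                              ≡⟨ cong (stepsAtRank t r +_) (+-identityʳ δ) ⟩
    stepsAtRank t r + δ                                    ≡⟨ +-comm (stepsAtRank t r) δ ⟩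
    stepsAtRank t (a ∷ r)                                  ∎
    where
    open ≡-Reasoning
    δ = fromBool (occ a r ≡ᵇ t)
    unchanged : ∀ x → ¬ x ≡ a → (t <ᵇ occ x (a ∷ r)) ≡ (t <ᵇ occ x r)
    unchanged x x≢a = cong (λ z → t <ᵇ (fromBool z + occ x r)) (≢⇒≡ᵇ≡false x a x≢a)
    grown : fromBool (t <ᵇ occ a (a ∷ r)) ≡ fromBool (t <ᵇ occ a r) + δ
    grown = trans (cong (λ z → fromBool (t <ᵇ (fromBool z + occ a r))) (≡ᵇ-refl a)) (fromBool-<ᵇ-suc t (occ a r))
    a-once : occ a (upTo B) ≡ 1
    a-once = AtMostOnce⇒occ≡1 a (upTo B) (Increasing⇒AtMostOnce (Increasing-upTo B)) (∈-upTo⁺ (h (here refl)))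

  +≡⇒≡∸+1 : ∀ c y x → c + y ≡ x → y + 1 ≤ x → c ≡ x ∸ (y + 1) + 1
  +≡⇒≡∸+1 c zero    (suc x) h _        = trans (sym (+-identityʳ c)) (trans h (+-comm 1 x))
  +≡⇒≡∸+1 c (suc y) (suc x) h (s≤s le) = +≡⇒≡∸+1 c y x (suc-injective (trans (sym (+-suc c y)) h)) le

  module Fibre {n : ℕ} {T : Array} (ST : IsSYT n T) where

    stepsAtRank≡countUpTo : ∀ t r → Valid (fitsColumn T) r → stepsAtRank t r ≡ countUpTo (inColumn T t) (length r)
    stepsAtRank≡countUpTo t []      _           = refl
    stepsAtRank≡countUpTo t (a ∷ r) (_ , q , v) = begin
      fromBool (occ a r ≡ᵇ t) + stepsAtRank t r
        ≡⟨ cong₂ _+_ (cong (λ z → fromBool (z ≡ᵇ t)) (≡ᵇ≡true⇒≡ (occ a r) (colOf m T) q)) (stepsAtRank≡countUpTo t r v) ⟩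
      fromBool (inColumn T t m) + countUpTo (inColumn T t) (length r)
        ≡⟨ +-comm (fromBool (inColumn T t m)) _ ⟩
      countUpTo (inColumn T t) (length r) + fromBool (inColumn T t m)
        ≡⟨ countUpTo-suc (inColumn T t) (length r) ⟨
      countUpTo (inColumn T t) m ∎
      where
      open ≡-Reasoning
      m = suc (length r)

    blocksAbove≡countUpTo : ∀ t r → Valid (fitsColumn T) r →
                            count (λ a → t <ᵇ occ a r) (upTo (suc (length r))) ≡ countUpTo (inColumn T t) (length r)
    blocksAbove≡countUpTo t r v = trans (blocksAbove≡stepsAtRank t (suc (length r)) r (λ m → ≤-trans (Valid⇒∈< _ r v m) (n≤1+n _)))
                                        (stepsAtRank≡countUpTo t r v)

    emptyBlocks : ∀ r → Valid (fitsColumn T) r →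
                  count (λ a → occ a r ≡ᵇ 0) (upTo (suc (length r))) + countUpTo (inColumn T 0) (length r) ≡ suc (length r)
    emptyBlocks r v = begin
      count (λ a → occ a r ≡ᵇ 0) (upTo (suc m)) + countUpTo (inColumn T 0) m                ≡⟨ cong (_ +_) (blocksAbove≡countUpTo 0 r v) ⟨
      count (λ a → occ a r ≡ᵇ 0) (upTo (suc m)) + count (λ a → 0 <ᵇ occ a r) (upTo (suc m))
        ≡⟨ count-split (λ a → occ a r ≡ᵇ 0) (λ a → 0 <ᵇ occ a r) (λ _ → true) (upTo (suc m)) (λ x → zero-or-positive (occ x r)) ⟩
      count (λ _ → true) (upTo (suc m))                                                     ≡⟨ count-true (upTo (suc m)) ⟩
      length (upTo (suc m))                                                                 ≡⟨ length-applyUpTo (λ i → i) (suc m) ⟩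
      suc m                                                                                 ∎
      where
      open ≡-Reasoning
      m = length r
      zero-or-positive : ∀ c → fromBool (c ≡ᵇ 0) + fromBool (0 <ᵇ c) ≡ 1
      zero-or-positive zero    = refl
      zero-or-positive (suc c) = refl

    blocksOfSize-suc : ∀ j r → Valid (fitsColumn T) r →
                       count (λ a → occ a r ≡ᵇ suc j) (upTo (suc (length r))) + countUpTo (inColumn T (suc j)) (length r)
                       ≡ countUpTo (inColumn T j) (length r)
    blocksOfSize-suc j r v = begin
      count (λ a → occ a r ≡ᵇ suc j) (upTo (suc m)) + countUpTo (inColumn T (suc j)) m          ≡⟨ cong (_ +_) (blocksAbove≡countUpTo (suc j) r v) ⟨
      count (λ a → occ a r ≡ᵇ suc j) (upTo (suc m)) + count (λ a → suc j <ᵇ occ a r) (upTo (suc m))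
        ≡⟨ count-split (λ a → occ a r ≡ᵇ suc j) (λ a → suc j <ᵇ occ a r) (λ a → j <ᵇ occ a r) (upTo (suc m))
                       (λ x → exact-or-larger (occ x r) j) ⟩
      count (λ a → j <ᵇ occ a r) (upTo (suc m))                                                 ≡⟨ blocksAbove≡countUpTo j r v ⟩
      countUpTo (inColumn T j) m                                                                ∎
      where
      open ≡-Reasoning
      m = length r
      exact-or-larger : ∀ c j → fromBool (c ≡ᵇ suc j) + fromBool (suc j <ᵇ c) ≡ fromBool (j <ᵇ c)
      exact-or-larger zero    j       = refl
      exact-or-larger (suc c) zero    with c
      ... | zero  = refl
      ... | suc _ = refl
      exact-or-larger (suc c) (suc j) = exact-or-larger c j

    -- In the first column the choices for element m + 1 are the still empty blocks.
    choices≡σ-firstColumn : ∀ r → Valid (fitsColumn T) r → suc (length r) ≤ n → colOf (suc (length r)) T ≡ 0 →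
                            count (λ a → fitsColumn T (length r) a r) (upTo (suc (length r))) ≡ σ T (suc (length r))
    choices≡σ-firstColumn r v le col≡0 = begin
      count (λ a → fitsColumn T m a r) (upTo (suc m)) ≡⟨ count-cong _ _ (upTo (suc m)) (λ x _ → cong (occ x r ≡ᵇ_) col≡0) ⟩
      count (λ a → occ a r ≡ᵇ 0) (upTo (suc m))       ≡⟨ +≡⇒≡∸+1 _ _ (suc m) (emptyBlocks r v) bounded ⟩
      suc m ∸ (countUpTo (inColumn T 0) m + 1) + 1    ≡⟨ cong (λ z → suc m ∸ z + 1) firstColumn ⟨
      suc m ∸ col 1 (restrict (suc m) T) + 1          ≡⟨ σ-unfold ⟨
      σ T (suc m)                                     ∎
      where
      open ≡-Reasoning
      m = length r
      bounded : countUpTo (inColumn T 0) m + 1 ≤ suc m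
      bounded = subst (countUpTo (inColumn T 0) m + 1 ≤_) (+-comm m 1) (+-monoˡ-≤ 1 (countUpTo≤ (inColumn T 0) m))
      firstColumn : col 1 (restrict (suc m) T) ≡ countUpTo (inColumn T 0) m + 1
      firstColumn = trans (col-restrict ST 0 (suc m) le) (countUpTo-inColumn-own T m col≡0)
      σ-unfold : σ T (suc m) ≡ suc m ∸ col 1 (restrict (suc m) T) + 1
      σ-unfold rewrite col≡0 = refl

    -- In column j + 1 the choices are the blocks of size exactly j + 1; the dominance of column j
    -- over column j + 1 makes the truncated subtraction in σ exact.
    choices≡σ-laterColumn : ∀ r j → Valid (fitsColumn T) r → suc (length r) ≤ n → colOf (suc (length r)) T ≡ suc j →
                            count (λ a → fitsColumn T (length r) a r) (upTo (suc (length r))) ≡ σ T (suc (length r))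
    choices≡σ-laterColumn r j v le col≡ = begin
      count (λ a → fitsColumn T m a r) (upTo (suc m))      ≡⟨ count-cong _ _ (upTo (suc m)) (λ x _ → cong (occ x r ≡ᵇ_) col≡) ⟩
      count (λ a → occ a r ≡ᵇ suc j) (upTo (suc m))        ≡⟨ +≡⇒≡∸+1 _ _ _ (blocksOfSize-suc j r v) dominated ⟩
      Cj m ∸ (Csj m + 1) + 1                               ≡⟨ cong₂ (λ a b → a ∸ b + 1) columnJ columnSJ ⟨
      col (suc j) (restrict (suc m) T) ∸ col (suc (suc j)) (restrict (suc m) T) + 1 ≡⟨ σ-unfold ⟨
      σ T (suc m)                                          ∎
      where
      open ≡-Reasoning
      m = length r
      Cj Csj : ℕ → ℕ
      Cj  = countUpTo (inColumn T j)
      Csj = countUpTo (inColumn T (suc j))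
      columnJ : col (suc j) (restrict (suc m) T) ≡ Cj m
      columnJ = trans (col-restrict ST j (suc m) le) (countUpTo-inColumn-other T m (λ e → 1+n≢n (trans (sym col≡) e)))
      columnSJ : col (suc (suc j)) (restrict (suc m) T) ≡ Csj m + 1
      columnSJ = trans (col-restrict ST (suc j) (suc m) le) (countUpTo-inColumn-own T m col≡)
      dominated : Csj m + 1 ≤ Cj m
      dominated = subst (_≤ Cj m) (countUpTo-inColumn-own T m col≡) (countUpTo-inColumn-dominance ST j m le)
      σ-unfold : σ T (suc m) ≡ col (suc j) (restrict (suc m) T) ∸ col (suc (suc j)) (restrict (suc m) T) + 1
      σ-unfold rewrite col≡ = refl

    choices≡σ : ∀ r → Valid (fitsColumn T) r → suc (length r) ≤ n →
                count (λ a → fitsColumn T (length r) a r) (upTo (suc (length r))) ≡ σ T (suc (length r))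
    choices≡σ r v le = byColumn (colOf (suc (length r)) T) refl
      where
      byColumn : ∀ k → colOf (suc (length r)) T ≡ k →
                 count (λ a → fitsColumn T (length r) a r) (upTo (suc (length r))) ≡ σ T (suc (length r))
      byColumn zero    col≡ = choices≡σ-firstColumn r v le col≡
      byColumn (suc j) col≡ = choices≡σ-laterColumn r j v le col≡

    length-assignments-fitsColumn : ∀ m → m ≤ n → length (assignments (fitsColumn T) m) ≡ product (map (σ T) (range1 m))
    length-assignments-fitsColumn zero    _  = refl
    length-assignments-fitsColumn (suc m) le = begin
      length (assignments (fitsColumn T) (suc m))                ≡⟨ length-assignments-suc (fitsColumn T) m (σ T (suc m)) choices ⟩
      length (assignments (fitsColumn T) m) * σ T (suc m)         ≡⟨ cong (_* σ T (suc m)) (length-assignments-fitsColumn m (≤-trans (n≤1+n m) le)) ⟩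
      product (map (σ T) (range1 m)) * σ T (suc m)                ≡⟨ cong (product (map (σ T) (range1 m)) *_) (*-identityʳ _) ⟨
      product (map (σ T) (range1 m)) * product (map (σ T) (suc m ∷ [])) ≡⟨ product-++ (map (σ T) (range1 m)) _ ⟨
      product (map (σ T) (range1 m) ++ map (σ T) (suc m ∷ []))    ≡⟨ cong product (map-++ (σ T) (range1 m) _) ⟨
      product (map (σ T) (range1 m ++ suc m ∷ []))                ≡⟨ cong (product ∘ map (σ T)) (range1-snoc m) ⟨
      product (map (σ T) (range1 (suc m)))                        ∎
      where
      open ≡-Reasoning
      choices : ∀ {r} → r ∈ assignments (fitsColumn T) m → count (λ a → fitsColumn T m a r) (upTo (suc m)) ≡ σ T (suc m)
      choices {r} mem with ∈-assignments⁻ (fitsColumn T) m mem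
      ... | refl , v = choices≡σ r v le

    fibre : List (WeakPartition n)
    fibre = map (toWeakPartition n) (assignments (fitsColumn T) n)

    ∈-fibre⁻ : 1 ≤ n → ∀ {p} → p ∈ fibre → IsOWP n p × φ p ≡ T
    ∈-fibre⁻ 1≤n mem with ∈-map⁻ (toWeakPartition n) mem
    ... | r , mr , refl with ∈-assignments⁻ (fitsColumn T) n mr
    ...   | refl , v = blockIndex<⇒IsOWP p 1≤n (λ e l₁ l₂ → subst (_< e) (sym (blockIndex≡ e l₁ l₂)) (proj₁ (fits e l₁ l₂)))
                     , trans (φ≡Φ p) (BlockTableau.rank≡colOf⇒Φ≡ n (blockIndex p) (blockIndex≤ p) T ST rank≡)
      where
      p = toWeakPartition (length r) r
      fits = Valid⇒Fits T r v
      blockIndex≡ = blockIndex-valid (fitsColumn T) (length r) r refl v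
      rank≡ : ∀ {e} → e ∈ range1 (length r) → BlockTableau.rank (length r) (blockIndex p) (blockIndex≤ p) e ≡ colOf e T
      rank≡ {e} m with ∈-range1⁻ m
      ... | l₁ , l₂ = trans (countUpTo-cong _ _ (pred e) (λ x x₁ x₂ → cong₂ _≡ᵇ_ (blockIndex≡ x x₁ (≤-trans x₂ (≤-trans pred[n]≤n l₂)))
                                                                                 (blockIndex≡ e l₁ l₂)))
                            (proj₂ (fits e l₁ l₂))

    ∈-fibre⁺ : ∀ {p} → IsOWP n p → φ p ≡ T → p ∈ fibre
    ∈-fibre⁺ {p} owp φp≡T = subst (_∈ fibre) (toWeakPartition-assignmentOf p)
      (∈-map⁺ (toWeakPartition n) (∈-assignments⁺ (fitsColumn T) n r (length-assignmentOf p n) (Fits⇒Valid T r fits)))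
      where
      r = assignmentOf p n
      fits : Fits T r
      fits e l₁ l₂′ with subst (e ≤_) (length-assignmentOf p n) l₂′
      ... | l₂ rewrite blockAt-assignmentOf p n e l₁ l₂ =
        IsOWP⇒blockIndex< p owp e l₁ l₂ ,
        trans (countUpTo-cong _ _ (pred e) (λ x x₁ x₂ →
                 cong (_≡ᵇ blockIndex p e) (blockAt-assignmentOf p n x x₁ (≤-trans x₂ (≤-trans pred[n]≤n l₂)))))
              (BlockTableau.Φ≡⇒rank≡colOf n (blockIndex p) (blockIndex≤ p) T (trans (sym (φ≡Φ p)) φp≡T) (∈-range1⁺ l₁ l₂))

    fibre-Unique : Unique fibre
    fibre-Unique = map⁺-injectiveOn (toWeakPartition n) (assignments-Unique (fitsColumn T) n)
                     (toWeakPartition-injective (fitsColumn T) n)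

    length-fibre : length fibre ≡ σProd n T
    length-fibre = trans (length-map (toWeakPartition n) (assignments (fitsColumn T) n)) (length-assignments-fitsColumn n ≤-refl)

  fibre-size : ∀ {n T} → 1 ≤ n → IsSYT n T → (ps : List (WeakPartition n)) → Unique ps →
               (∀ p → (p ∈ ps) ⇔ (IsOWP n p × φ p ≡ T)) → length ps ≡ σProd n T
  fibre-size {n} {T} 1≤n ST ps ps-Unique ps⇔ = begin
    length ps    ≡⟨ sameElements⇒length≡ ps-Unique fibre-Unique
                      (λ p m → let (owp , φp≡T) = Equivalence.to (ps⇔ p) m in ∈-fibre⁺ owp φp≡T)
                      (λ p m → Equivalence.from (ps⇔ p) (∈-fibre⁻ 1≤n m)) ⟩
    length fibre ≡⟨ length-fibre ⟩
    σProd n T    ∎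
    where
    open Fibre ST
    open ≡-Reasoning

  φ-IsSYT : ∀ {n} (p : WeakPartition n) → IsSYT n (φ p)
  φ-IsSYT {n} p = subst (IsSYT n) (sym (φ≡Φ p)) (BlockTableau.Φ-IsSYT n (blockIndex p) (blockIndex≤ p))

  allOWP : (n : ℕ) → List (WeakPartition n)
  allOWP n = map (toWeakPartition n) (assignments anyBlock n)

  ∈-allOWP⁻ : ∀ {n p} → 1 ≤ n → p ∈ allOWP n → IsOWP n p
  ∈-allOWP⁻ {n} 1≤n mem with ∈-map⁻ (toWeakPartition n) mem
  ... | r , mr , refl with ∈-assignments⁻ anyBlock n mr
  ...   | l , v = blockIndex<⇒IsOWP _ 1≤n (λ e l₁ l₂ → let e≤ = subst (e ≤_) (sym l) l₂ in
                    subst (_< e) (sym (blockIndex-valid anyBlock n r l v e l₁ l₂)) (Valid⇒blockAt< anyBlock r v e l₁ e≤))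

  ∈-allOWP⁺ : ∀ {n p} → IsOWP n p → p ∈ allOWP n
  ∈-allOWP⁺ {n} {p} owp = subst (_∈ allOWP n) (toWeakPartition-assignmentOf p)
    (∈-map⁺ (toWeakPartition n) (∈-assignments⁺ anyBlock n r (length-assignmentOf p n) (blockAt<⇒Valid-anyBlock r blockAt<)))
    where
    r = assignmentOf p n
    blockAt< : ∀ e → 1 ≤ e → e ≤ length r → blockAt r e < e
    blockAt< e l₁ l₂ = let e≤n = subst (e ≤_) (length-assignmentOf p n) l₂ in
      subst (_< e) (sym (blockAt-assignmentOf p n e l₁ e≤n)) (IsOWP⇒blockIndex< p owp e l₁ e≤n)

  allOWP-Unique : ∀ n → Unique (allOWP n)
  allOWP-Unique n = map⁺-injectiveOn (toWeakPartition n) (assignments-Unique anyBlock n) (toWeakPartition-injective anyBlock n)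

  concatMap-fibres↭allOWP : ∀ {n} → 1 ≤ n → (Ts : List Array) → Unique Ts → (∀ T → (T ∈ Ts) ⇔ IsSYT n T) →
                            (pre : Array → List (WeakPartition n)) → (∀ T → Unique (pre T)) →
                            (∀ T p → (p ∈ pre T) ⇔ (IsOWP n p × φ p ≡ T)) → concatMap pre Ts ↭ allOWP n
  concatMap-fibres↭allOWP {n} 1≤n Ts Ts-Unique Ts⇔ pre pre-Unique pre⇔ =
    sameElements⇒↭ fibres-Unique (allOWP-Unique n) (λ p m → ∈-allOWP⁺ (∈-fibres⁻ m)) (λ p m → ∈-fibres⁺ (∈-allOWP⁻ 1≤n m))
    where
    fibres-Unique : Unique (concatMap pre Ts)
    fibres-Unique = concat⁺ (AllP.map⁺ (All.tabulate (λ {T} _ → pre-Unique T))) (AllPairs.map⁺ (AllPairs.map disjoint Ts-Unique))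
      where
      disjoint : ∀ {T T′} → ¬ T ≡ T′ → Disjoint (pre T) (pre T′)
      disjoint T≢T′ (m₁ , m₂) = T≢T′ (trans (sym (proj₂ (Equivalence.to (pre⇔ _ _) m₁))) (proj₂ (Equivalence.to (pre⇔ _ _) m₂)))
    ∈-fibres⁻ : ∀ {p} → p ∈ concatMap pre Ts → IsOWP n p
    ∈-fibres⁻ {p} m with ∈-concat⁻′ (map pre Ts) m
    ... | _ , mp , mxs with ∈-map⁻ pre mxs
    ...   | T , _ , refl = proj₁ (Equivalence.to (pre⇔ T p) mp)
    ∈-fibres⁺ : ∀ {p} → IsOWP n p → p ∈ concatMap pre Ts
    ∈-fibres⁺ {p} owp = ∈-concat⁺′ (Equivalence.from (pre⇔ (φ p) p) (owp , refl)) (∈-map⁺ pre (Equivalence.from (Ts⇔ (φ p)) (φ-IsSYT p)))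

  blockSizes : ℕ → List ℕ → List ℕ
  blockSizes m r = applyUpTo (λ i → occ i r) (suc m)

  module ShapeOfAssignment {n r} (r∈ : r ∈ assignments anyBlock n) where

    private
      p = toWeakPartition n r
      open BlockTableau n (blockIndex p) (blockIndex≤ p)

      length≡n = proj₁ (∈-assignments⁻ anyBlock n r∈)
      valid = proj₂ (∈-assignments⁻ anyBlock n r∈)

      length-B : ∀ i → length (B i) ≡ occ i r
      length-B i = begin
        length (B i)
          ≡⟨ length-filterᵇ _ (range1 n) ⟩
        countUpTo (λ e → blockIndex p e ≡ᵇ i) n
          ≡⟨ countUpTo-cong _ _ n (λ e l₁ l₂ → cong (_≡ᵇ i) (blockIndex-valid anyBlock n r length≡n valid e l₁ l₂)) ⟩
        countUpTo (λ e → blockAt r e ≡ᵇ i) n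
          ≡⟨ cong (countUpTo (λ e → blockAt r e ≡ᵇ i)) length≡n ⟨
        countUpTo (λ e → blockAt r e ≡ᵇ i) (length r)
          ≡⟨ occ≡countUpTo-blockAt i r ⟨
        occ i r ∎
        where open ≡-Reasoning

      map-length-blocks : map length blocks ≡ blockSizes n r
      map-length-blocks = trans (sym (map-∘ (upTo (suc n)))) (trans (map-upTo _ (suc n)) (applyUpTo-cong _ _ (suc n) (λ i _ → length-B i)))

    rowsOfLength-φ : ∀ i → 1 ≤ i → rowsOfLength i (φ p) ≡ count (_≡ᵇ i) (blockSizes n r)
    rowsOfLength-φ i 1≤i = begin
      rowsOfLength i (φ p)                        ≡⟨ cong (rowsOfLength i) (φ≡Φ p) ⟩
      rowsOfLength i (Φ n (blockIndex p))         ≡⟨ rowsOfLength-Φ i 1≤i ⟩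
      count (λ b → length b ≡ᵇ i) blocks          ≡⟨ count-map (_≡ᵇ i) length blocks ⟨
      count (_≡ᵇ i) (map length blocks)           ≡⟨ cong (count (_≡ᵇ i)) map-length-blocks ⟩
      count (_≡ᵇ i) (blockSizes n r)              ∎
      where open ≡-Reasoning

    unusedBlocks-φ : suc n ∸ numRows (φ p) ≡ count (_≡ᵇ 0) (blockSizes n r)
    unusedBlocks-φ = begin
      suc n ∸ numRows (φ p)
        ≡⟨ cong (λ k → suc n ∸ numRows k) (φ≡Φ p) ⟩
      suc n ∸ numRows (Φ n (blockIndex p))
        ≡⟨ cong (suc n ∸_) numRows≡ ⟩
      suc n ∸ count (0 <ᵇ_) vs
        ≡⟨ cong (_∸ count (0 <ᵇ_) vs) (trans (sym (length-applyUpTo (λ i → occ i r) (suc n))) (sym empty+used)) ⟩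
      (count (_≡ᵇ 0) vs + count (0 <ᵇ_) vs) ∸ count (0 <ᵇ_) vs
        ≡⟨ m+n∸n≡m (count (_≡ᵇ 0) vs) (count (0 <ᵇ_) vs) ⟩
      count (_≡ᵇ 0) vs ∎
      where
      open ≡-Reasoning
      vs = blockSizes n r
      numRows≡ : numRows (Φ n (blockIndex p)) ≡ count (0 <ᵇ_) vs
      numRows≡ = trans numRows-Φ (trans (count-cong _ _ blocks (λ b _ → isNonEmpty≡ b))
                   (trans (sym (count-map (0 <ᵇ_) length blocks)) (cong (count (0 <ᵇ_)) map-length-blocks)))
        where
        isNonEmpty≡ : ∀ (b : List ℕ) → isNonEmpty b ≡ (0 <ᵇ length b)
        isNonEmpty≡ []      = refl
        isNonEmpty≡ (_ ∷ _) = refl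
      empty+used : count (_≡ᵇ 0) vs + count (0 <ᵇ_) vs ≡ length vs
      empty+used = trans (count-split (_≡ᵇ 0) (0 <ᵇ_) (λ _ → true) vs zero-or-positive) (count-true vs)
        where
        zero-or-positive : ∀ w → fromBool (w ≡ᵇ 0) + fromBool (0 <ᵇ w) ≡ 1
        zero-or-positive zero    = refl
        zero-or-positive (suc _) = refl

    blockSizes≤ : ∀ {v} → v ∈ blockSizes n r → v ≤ n
    blockSizes≤ m with ∈-applyUpTo⁻ (λ i → occ i r) m
    ... | i , _ , refl = ≤-trans (count≤length _ r) (≤-reflexive length≡n)

module DifferentialRing {r ℓ : Level} (R : CommutativeRing r ℓ) (D : CommutativeRing.Carrier R → CommutativeRing.Carrier R)
                        (isD : IsDerivation R D) where

  open CommutativeRing R renaming (Carrier to C) hiding (zero)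
  open IsDerivation isD
  open Counting using (count; fromBool; occ; ≡ᵇ≡true⇒≡; ∉⇒occ≡0; ∈-range1⁻; occ-range1)
  open Arrays using (applyUpTo-cong)
  open Assignments using (anyBlock; assignments; extensions; ∈-assignments⁻; Valid⇒∈<; toWeakPartition; allOWP;
                          concatMap-fibres↭allOWP; blockSizes; module ShapeOfAssignment; fibre-size)
  open import Data.Nat as ℕ using (zero; suc; z≤n; s≤s; _≡ᵇ_; _∸_)
  import Data.Nat.Properties as ℕ
  open import Data.Product using (proj₁; proj₂)
  open import Data.List.Membership.Propositional using (_∉_)
  open import Data.List.Membership.Propositional.Properties using (∈-upTo⁻)
  open import Data.List.Relation.Unary.Unique.Propositional using (Unique)
  open import Function.Bundles using (Equivalence)
  open import Data.Bool using (true; false)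
  open import Data.Nat.ListAction using (product)
  open import Algebra.Bundles using (Semiring)
  open import Data.List using ([]; _∷_; concatMap; _++_; upTo; applyUpTo; filterᵇ)
  import Data.List.Properties as List
  open import Data.List.Relation.Unary.Any using (here; there)
  open import Data.List.Relation.Binary.Permutation.Propositional as ↭ using (_↭_)
  open import Function using (_∘_)
  import Relation.Binary.PropositionalEquality as ≡
  open import Relation.Binary.Reasoning.Setoid setoid
  open import Algebra.Definitions.RawSemiring (Semiring.rawSemiring semiring) using (_^_) renaming (_×_ to _·_)
  import Algebra.Properties.CommutativeSemigroup as CommutativeSemigroup
  module +-CS = CommutativeSemigroup +-commutativeSemigroup
  module *-CS = CommutativeSemigroup *-commutativeSemigroup
  open import Algebra.Properties.Semiring.Mult semiring using (×-assoc-*; ×-comm-*; ×-assocˡ; ×-congʳ)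

  ∑ : List C → C
  ∑ = ringSum R

  ∏ : List C → C
  ∏ = ringProd R

  ∑-++ : ∀ xs ys → ∑ (xs ++ ys) ≈ ∑ xs + ∑ ys
  ∑-++ []       ys = sym (+-identityˡ _)
  ∑-++ (x ∷ xs) ys = trans (+-congˡ (∑-++ xs ys)) (sym (+-assoc x _ _))

  ∏-++ : ∀ xs ys → ∏ (xs ++ ys) ≈ ∏ xs * ∏ ys
  ∏-++ []       ys = sym (*-identityˡ _)
  ∏-++ (x ∷ xs) ys = trans (*-congˡ (∏-++ xs ys)) (sym (*-assoc x _ _))

  ∑-cong : ∀ {A : Set} {h h′ : A → C} xs → (∀ {x} → x ∈ xs → h x ≈ h′ x) → ∑ (map h xs) ≈ ∑ (map h′ xs)
  ∑-cong []       e = refl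
  ∑-cong (x ∷ xs) e = +-cong (e (here ≡.refl)) (∑-cong xs (e ∘ there))

  ∏-cong : ∀ {A : Set} {h h′ : A → C} xs → (∀ {x} → x ∈ xs → h x ≈ h′ x) → ∏ (map h xs) ≈ ∏ (map h′ xs)
  ∏-cong []       e = refl
  ∏-cong (x ∷ xs) e = *-cong (e (here ≡.refl)) (∏-cong xs (e ∘ there))

  ∑-map : ∀ {a b} {A : Set a} {B : Set b} (h : B → C) (g : A → B) xs → ∑ (map h (map g xs)) ≈ ∑ (map (h ∘ g) xs)
  ∑-map h g xs = reflexive (≡.cong ∑ (≡.sym (List.map-∘ xs)))

  ∑-concatMap : ∀ {A B : Set} (h : B → C) (g : A → List B) ys → ∑ (map h (concatMap g ys)) ≈ ∑ (map (λ y → ∑ (map h (g y))) ys)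
  ∑-concatMap h g []       = refl
  ∑-concatMap h g (y ∷ ys) = begin
    ∑ (map h (g y ++ concatMap g ys))             ≡⟨ ≡.cong ∑ (List.map-++ h (g y) (concatMap g ys)) ⟩
    ∑ (map h (g y) ++ map h (concatMap g ys))     ≈⟨ ∑-++ (map h (g y)) _ ⟩
    ∑ (map h (g y)) + ∑ (map h (concatMap g ys))  ≈⟨ +-congˡ (∑-concatMap h g ys) ⟩
    ∑ (map (λ y → ∑ (map h (g y))) (y ∷ ys))      ∎

  ∑-↭ : ∀ {A : Set} (h : A → C) {xs ys} → xs ↭ ys → ∑ (map h xs) ≈ ∑ (map h ys)
  ∑-↭ h ↭.refl         = refl
  ∑-↭ h (↭.prep x p)   = +-congˡ (∑-↭ h p)
  ∑-↭ h (↭.swap x y p) = trans (+-congˡ (+-congˡ (∑-↭ h p))) (+-CS.x∙yz≈y∙xz (h x) (h y) _)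
  ∑-↭ h (↭.trans p q)  = trans (∑-↭ h p) (∑-↭ h q)

  ∑-*ʳ : ∀ {A : Set} (h : A → C) xs y → ∑ (map h xs) * y ≈ ∑ (map (λ x → h x * y) xs)
  ∑-*ʳ h []       y = zeroˡ y
  ∑-*ʳ h (x ∷ xs) y = trans (distribʳ y (h x) _) (+-congˡ (∑-*ʳ h xs y))

  ∑-*ˡ : ∀ {A : Set} (h : A → C) xs y → y * ∑ (map h xs) ≈ ∑ (map (λ x → y * h x) xs)
  ∑-*ˡ h []       y = zeroʳ y
  ∑-*ˡ h (x ∷ xs) y = trans (distribˡ y (h x) _) (+-congˡ (∑-*ˡ h xs y))

  ∑-const : ∀ {A : Set} (h : A → C) xs v → (∀ {x} → x ∈ xs → h x ≈ v) → ∑ (map h xs) ≈ length xs · v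
  ∑-const h []       v e = refl
  ∑-const h (x ∷ xs) v e = +-cong (e (here ≡.refl)) (∑-const h xs v (e ∘ there))

  ∏-ones : ∀ {A : Set} (xs : List A) → ∏ (map (λ _ → 1#) xs) ≈ 1#
  ∏-ones []       = refl
  ∏-ones (x ∷ xs) = trans (*-congˡ (∏-ones xs)) (*-identityʳ 1#)

  ∏-· : ∀ (a : ℕ → ℕ) (x : ℕ → C) (l : List ℕ) → ∏ (map (λ i → a i · x i) l) ≈ product (map a l) · ∏ (map x l)
  ∏-· a x []      = sym (+-identityʳ 1#)
  ∏-· a x (i ∷ l) = begin
    (a i · x i) * ∏ (map (λ i → a i · x i) l)          ≈⟨ *-congˡ (∏-· a x l) ⟩
    (a i · x i) * (product (map a l) · ∏ (map x l))    ≈⟨ ×-assoc-* (a i) (x i) _ ⟩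
    a i · (x i * (product (map a l) · ∏ (map x l)))    ≈⟨ ×-congʳ (a i) (×-comm-* (product (map a l)) (x i) _) ⟩
    a i · (product (map a l) · (x i * ∏ (map x l)))    ≈⟨ ×-assocˡ _ (a i) (product (map a l)) ⟩
    (a i ℕ.* product (map a l)) · (x i * ∏ (map x l))  ∎

  D-0# : D 0# ≈ 0#
  D-0# = begin
    D 0#                    ≈⟨ +-identityʳ _ ⟨
    D 0# + 0#               ≈⟨ +-congˡ (-‿inverseʳ (D 0#)) ⟨
    D 0# + (D 0# - D 0#)    ≈⟨ +-assoc _ _ _ ⟨
    (D 0# + D 0#) - D 0#    ≈⟨ +-congʳ (D-+ 0# 0#) ⟨
    D (0# + 0#) - D 0#      ≈⟨ +-congʳ (D-cong (+-identityʳ 0#)) ⟩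
    D 0# - D 0#             ≈⟨ -‿inverseʳ _ ⟩
    0#                      ∎

  D-1# : D 1# ≈ 0#
  D-1# = begin
    D 1#                              ≈⟨ +-identityʳ _ ⟨
    D 1# + 0#                         ≈⟨ +-congˡ (-‿inverseʳ (D 1#)) ⟨
    D 1# + (D 1# - D 1#)              ≈⟨ +-assoc _ _ _ ⟨
    (D 1# + D 1#) - D 1#              ≈⟨ +-congʳ (+-cong (*-identityʳ _) (*-identityˡ _)) ⟨
    (D 1# * 1# + 1# * D 1#) - D 1#    ≈⟨ +-congʳ (D-* 1# 1#) ⟨
    D (1# * 1#) - D 1#                ≈⟨ +-congʳ (D-cong (*-identityʳ 1#)) ⟩
    D 1# - D 1#                       ≈⟨ -‿inverseʳ _ ⟩
    0#                                ∎

  D-∑ : ∀ xs → D (∑ xs) ≈ ∑ (map D xs)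
  D-∑ []       = D-0#
  D-∑ (x ∷ xs) = trans (D-+ x _) (+-congˡ (D-∑ xs))

  derivative : C → ℕ → C
  derivative c v = iterD R D v c

  monomial : C → List ℕ → C
  monomial c vs = ∏ (map (derivative c) vs)

  incrementAt : ℕ → List ℕ → List ℕ
  incrementAt _       []       = []
  incrementAt zero    (v ∷ vs) = suc v ∷ vs
  incrementAt (suc j) (v ∷ vs) = v ∷ incrementAt j vs

  leibniz : ∀ c vs → D (monomial c vs) ≈ ∑ (map (λ j → monomial c (incrementAt j vs)) (upTo (length vs)))
  leibniz c []       = D-1#
  leibniz c (v ∷ vs) = begin
    D (derivative c v * monomial c vs)
      ≈⟨ D-* _ _ ⟩
    derivative c (suc v) * monomial c vs + derivative c v * D (monomial c vs)
      ≈⟨ +-congˡ (*-congˡ (leibniz c vs)) ⟩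
    monomial c (suc v ∷ vs) + derivative c v * ∑ (map (λ j → monomial c (incrementAt j vs)) (upTo (length vs)))
      ≈⟨ +-congˡ (∑-*ˡ _ (upTo (length vs)) _) ⟩
    monomial c (suc v ∷ vs) + ∑ (map (λ j → derivative c v * monomial c (incrementAt j vs)) (upTo (length vs)))
      ≡⟨ ≡.cong (λ z → monomial c (suc v ∷ vs) + ∑ z)
           (≡.trans (List.map-upTo _ (length vs)) (≡.sym (List.map-applyUpTo suc (λ j → monomial c (incrementAt j (v ∷ vs))) (length vs)))) ⟩
    monomial c (incrementAt 0 (v ∷ vs)) + ∑ (map (λ j → monomial c (incrementAt j (v ∷ vs))) (applyUpTo suc (length vs)))
      ∎

  ^-multiplicity : ∀ (F : ℕ → C) (e : ℕ → ℕ) v xs →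
                   ∏ (map (λ i → F i ^ (fromBool (v ≡ᵇ i) ℕ.+ e i)) xs) ≈ F v ^ count (v ≡ᵇ_) xs * ∏ (map (λ i → F i ^ e i) xs)
  ^-multiplicity F e v []       = sym (*-identityʳ 1#)
  ^-multiplicity F e v (x ∷ xs) with v ≡ᵇ x in eq
  ... | true rewrite ≡ᵇ≡true⇒≡ v x eq = begin
    (F x * F x ^ e x) * ∏ (map (λ i → F i ^ (fromBool (x ≡ᵇ i) ℕ.+ e i)) xs) ≈⟨ *-congˡ (^-multiplicity F e x xs) ⟩
    (F x * F x ^ e x) * (F x ^ count (x ≡ᵇ_) xs * Π′)                      ≈⟨ *-assoc _ _ _ ⟩
    F x * (F x ^ e x * (F x ^ count (x ≡ᵇ_) xs * Π′))                      ≈⟨ *-congˡ (*-CS.x∙yz≈y∙xz _ _ _) ⟩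
    F x * (F x ^ count (x ≡ᵇ_) xs * (F x ^ e x * Π′))                      ≈⟨ *-assoc _ _ _ ⟨
    (F x * F x ^ count (x ≡ᵇ_) xs) * (F x ^ e x * Π′)                      ∎
    where Π′ = ∏ (map (λ i → F i ^ e i) xs)
  ... | false = trans (*-congˡ (^-multiplicity F e v xs)) (*-CS.x∙yz≈y∙xz _ _ _)

  monomial-by-multiplicity : ∀ c N vs → (∀ {v} → v ∈ vs → v ≤ N) →
    monomial c vs ≈ c ^ count (_≡ᵇ 0) vs * ∏ (map (λ i → derivative c i ^ count (_≡ᵇ i) vs) (range1 N))
  monomial-by-multiplicity c N []            h = sym (trans (*-identityˡ _) (∏-ones (range1 N)))
  monomial-by-multiplicity c N (zero ∷ vs)   h = begin
    c * monomial c vs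
      ≈⟨ *-congˡ (monomial-by-multiplicity c N vs (h ∘ there)) ⟩
    c * (c ^ count (_≡ᵇ 0) vs * ∏ (map (power vs) (range1 N)))
      ≈⟨ *-assoc _ _ _ ⟨
    c ^ suc (count (_≡ᵇ 0) vs) * ∏ (map (power vs) (range1 N))
      ≈⟨ *-congˡ (∏-cong (range1 N) (λ {i} m →
           reflexive (≡.cong (λ b → derivative c i ^ (fromBool b ℕ.+ count (_≡ᵇ i) vs)) (≡.sym (0≢ m))))) ⟩
    c ^ suc (count (_≡ᵇ 0) vs) * ∏ (map (power (zero ∷ vs)) (range1 N)) ∎
    where
    power = λ ws i → derivative c i ^ count (_≡ᵇ i) ws
    0≢ : ∀ {i} → i ∈ range1 N → (0 ≡ᵇ i) ≡.≡ false
    0≢ m with ∈-range1⁻ m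
    ... | s≤s _ , _ = ≡.refl
  monomial-by-multiplicity c N (suc v ∷ vs) h = begin
    cᵥ * monomial c vs
      ≈⟨ *-congˡ (monomial-by-multiplicity c N vs (h ∘ there)) ⟩
    cᵥ * (c ^ z * Π′)
      ≈⟨ *-CS.x∙yz≈y∙xz _ _ _ ⟩
    c ^ z * (cᵥ * Π′)
      ≈⟨ *-congˡ (*-congʳ (*-identityʳ _)) ⟨
    c ^ z * (cᵥ ^ 1 * Π′)
      ≡⟨ ≡.cong (λ k → c ^ z * (cᵥ ^ k * Π′)) (≡.sym (occ-range1 (suc v) N (s≤s z≤n) (h (here ≡.refl)))) ⟩
    c ^ z * (cᵥ ^ count (suc v ≡ᵇ_) (range1 N) * Π′)
      ≈⟨ *-congˡ (^-multiplicity (derivative c) (λ i → count (_≡ᵇ i) vs) (suc v) (range1 N)) ⟨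
    c ^ z * ∏ (map (λ i → derivative c i ^ count (_≡ᵇ i) (suc v ∷ vs)) (range1 N)) ∎
    where
    cᵥ = derivative c (suc v)
    z  = count (_≡ᵇ 0) vs
    Π′ = ∏ (map (λ i → derivative c i ^ count (_≡ᵇ i) vs) (range1 N))

  incrementAt-applyUpTo : ∀ (h : ℕ → ℕ) K a → a ℕ.< K → incrementAt a (applyUpTo h K) ≡.≡ applyUpTo (λ i → h i ℕ.+ fromBool (i ≡ᵇ a)) K
  incrementAt-applyUpTo h (suc K) zero    _        =
    ≡.cong₂ _∷_ (ℕ.+-comm 1 (h 0)) (≡.sym (applyUpTo-cong _ _ K (λ i _ → ℕ.+-identityʳ (h (suc i)))))
  incrementAt-applyUpTo h (suc K) (suc a) (s≤s lt) =
    ≡.cong₂ _∷_ (≡.sym (ℕ.+-identityʳ (h 0))) (incrementAt-applyUpTo (h ∘ suc) K a lt)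

  blockSizes-∷ : ∀ m a r → a ℕ.< suc m → (∀ {b} → b ∈ r → b ℕ.< suc m) →
                 blockSizes (suc m) (a ∷ r) ≡.≡ incrementAt a (blockSizes m r) ++ 0 ∷ []
  blockSizes-∷ m a r a≤m r≤m = ≡.trans (≡.sym (List.applyUpTo-∷ʳ (λ i → occ i (a ∷ r)) (suc m)))
    (≡.cong₂ _++_ (≡.trans (applyUpTo-cong _ _ (suc m) (λ i _ → ℕ.+-comm (fromBool (i ≡ᵇ a)) (occ i r)))
                           (≡.sym (incrementAt-applyUpTo (λ i → occ i r) (suc m) a a≤m)))
                  (≡.cong (_∷ []) (∉⇒occ≡0 (a ∷ r) new∉)))
    where
    new∉ : suc m ∉ a ∷ r
    new∉ (here e)  = ℕ.<-irrefl (≡.sym e) a≤m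
    new∉ (there b) = ℕ.<-irrefl ≡.refl (r≤m b)

  monomial-∷ʳ-0 : ∀ c vs → monomial c (vs ++ 0 ∷ []) ≈ monomial c vs * c
  monomial-∷ʳ-0 c vs = begin
    ∏ (map (derivative c) (vs ++ 0 ∷ []))             ≡⟨ ≡.cong ∏ (List.map-++ (derivative c) vs (0 ∷ [])) ⟩
    ∏ (map (derivative c) vs ++ c ∷ [])               ≈⟨ ∏-++ (map (derivative c) vs) (c ∷ []) ⟩
    monomial c vs * (c * 1#)                          ≈⟨ *-congˡ (*-identityʳ c) ⟩
    monomial c vs * c                                 ∎

  -- Each application of cD adds the next element to some block a, raising that block's derivative order by Leibniz.
  cDpow≈∑monomial : ∀ c m → ∑ (map (monomial c ∘ blockSizes m) (assignments anyBlock m)) ≈ cDpow R D c m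
  cDpow≈∑monomial c zero    = trans (+-identityʳ _) (*-identityʳ c)
  cDpow≈∑monomial c (suc m) = begin
    ∑ (map W′ (concatMap (extensions anyBlock m) (assignments anyBlock m)))
      ≈⟨ ∑-concatMap W′ (extensions anyBlock m) (assignments anyBlock m) ⟩
    ∑ (map (λ r → ∑ (map W′ (extensions anyBlock m r))) (assignments anyBlock m))
      ≈⟨ ∑-cong (assignments anyBlock m) step ⟩
    ∑ (map (λ r → D (W r) * c) (assignments anyBlock m))
      ≈⟨ ∑-*ʳ (D ∘ W) (assignments anyBlock m) c ⟨
    ∑ (map (D ∘ W) (assignments anyBlock m)) * c
      ≈⟨ *-congʳ (∑-map D W (assignments anyBlock m)) ⟨
    ∑ (map D (map W (assignments anyBlock m))) * c
      ≈⟨ *-congʳ (D-∑ (map W (assignments anyBlock m))) ⟨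
    D (∑ (map W (assignments anyBlock m))) * c
      ≈⟨ *-congʳ (D-cong (cDpow≈∑monomial c m)) ⟩
    D (cDpow R D c m) * c
      ≈⟨ *-comm _ _ ⟩
    cDpow R D c (suc m) ∎
    where
    W  = monomial c ∘ blockSizes m
    W′ = monomial c ∘ blockSizes (suc m)
    filterᵇ-true : ∀ (xs : List ℕ) → filterᵇ (λ _ → true) xs ≡.≡ xs
    filterᵇ-true []       = ≡.refl
    filterᵇ-true (x ∷ xs) = ≡.cong (x ∷_) (filterᵇ-true xs)
    step : ∀ {r} → r ∈ assignments anyBlock m → ∑ (map W′ (extensions anyBlock m r)) ≈ D (W r) * c
    step {r} mem with ∈-assignments⁻ anyBlock m mem
    ... | ≡.refl , v = begin
      ∑ (map W′ (map (_∷ r) (filterᵇ (λ _ → true) (upTo (suc m)))))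
        ≡⟨ ≡.cong (λ z → ∑ (map W′ (map (_∷ r) z))) (filterᵇ-true (upTo (suc m))) ⟩
      ∑ (map W′ (map (_∷ r) (upTo (suc m))))
        ≈⟨ ∑-map W′ (_∷ r) (upTo (suc m)) ⟩
      ∑ (map (λ a → W′ (a ∷ r)) (upTo (suc m)))
        ≈⟨ ∑-cong (upTo (suc m)) extend ⟩
      ∑ (map (λ a → monomial c (incrementAt a (blockSizes m r)) * c) (upTo (suc m)))
        ≈⟨ ∑-*ʳ _ (upTo (suc m)) c ⟨
      ∑ (map (λ a → monomial c (incrementAt a (blockSizes m r))) (upTo (suc m))) * c
        ≡⟨ ≡.cong (λ k → ∑ (map (λ a → monomial c (incrementAt a (blockSizes m r))) (upTo k)) * c)
                                                                                           (≡.sym (List.length-applyUpTo (λ i → occ i r) (suc m))) ⟩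
      ∑ (map (λ a → monomial c (incrementAt a (blockSizes m r))) (upTo (length (blockSizes m r)))) * c
        ≈⟨ *-congʳ (leibniz c (blockSizes m r)) ⟨
      D (W r) * c ∎
      where
      extend : ∀ {a} → a ∈ upTo (suc m) → W′ (a ∷ r) ≈ monomial c (incrementAt a (blockSizes m r)) * c
      extend {a} am = trans (reflexive (≡.cong (monomial c)
                        (blockSizes-∷ m a r (∈-upTo⁻ am) (λ b → ℕ.≤-trans (Valid⇒∈< anyBlock r v b) (ℕ.n≤1+n _)))))
                            (monomial-∷ʳ-0 c (incrementAt a (blockSizes m r)))

  weight-φ-toWeakPartition : ∀ c n {r} → r ∈ assignments anyBlock n → weight R D c n (φ (toWeakPartition n r)) ≈ monomial c (blockSizes n r)
  weight-φ-toWeakPartition c n {r} r∈ = begin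
    c ^ (suc n ∸ numRows (φ p)) * ∏ (map (λ i → derivative c i ^ rowsOfLength i (φ p)) (range1 n))
      ≈⟨ *-cong (reflexive (≡.cong (c ^_) unusedBlocks-φ))
                (∏-cong (range1 n) (λ {i} m → reflexive (≡.cong (derivative c i ^_) (rowsOfLength-φ i (proj₁ (∈-range1⁻ m)))))) ⟩
    c ^ count (_≡ᵇ 0) vs * ∏ (map (λ i → derivative c i ^ count (_≡ᵇ i) vs) (range1 n))
      ≈⟨ monomial-by-multiplicity c n vs blockSizes≤ ⟨
    monomial c vs
      ∎
    where
    open ShapeOfAssignment {n} r∈
    p  = toWeakPartition n r
    vs = blockSizes n r

  σTerm≈natScale : ∀ c n T → σTerm R D c n T ≈ natScale R (σProd n T) (weight R D c n T)
  σTerm≈natScale c n T = begin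
    ∏ (map (λ i → σ T i · x i) (range1 n)) * c₀                ≈⟨ *-congʳ (∏-· (σ T) x (range1 n)) ⟩
    (σProd n T · ∏ (map x (range1 n))) * c₀                    ≈⟨ ×-assoc-* (σProd n T) _ _ ⟩
    σProd n T · (∏ (map x (range1 n)) * c₀)                    ≈⟨ ×-congʳ (σProd n T) (*-comm _ _) ⟩
    natScale R (σProd n T) (weight R D c n T)                  ∎
    where
    x  = λ i → derivative c i ^ rowsOfLength i T
    c₀ = c ^ (suc n ∸ numRows T)

  module _ {n : ℕ} (1≤n : 1 ≤ n) (c : C)
           (Ts : List Array) (Ts-Unique : Unique Ts) (Ts⇔ : ∀ T → (T ∈ Ts) ⇔ IsSYT n T)
           (pre : Array → List (WeakPartition n)) (pre-Unique : ∀ T → Unique (pre T))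
           (pre⇔ : ∀ T p → (p ∈ pre T) ⇔ (IsOWP n p × φ p ≡ T)) where

    private
      w : Array → C
      w = weight R D c n

    cDpow≈∑fibres : cDpow R D c n ≈ ∑ (map (λ T → natScale R (length (pre T)) (w T)) Ts)
    cDpow≈∑fibres = sym (begin
      ∑ (map (λ T → natScale R (length (pre T)) (w T)) Ts)
        ≈⟨ ∑-cong Ts (λ {T} _ → ∑-const (w ∘ φ) (pre T) (w T) (λ m → reflexive (≡.cong w (proj₂ (Equivalence.to (pre⇔ T _) m))))) ⟨
      ∑ (map (λ T → ∑ (map (w ∘ φ) (pre T))) Ts)
        ≈⟨ ∑-concatMap (w ∘ φ) pre Ts ⟨
      ∑ (map (w ∘ φ) (concatMap pre Ts))
        ≈⟨ ∑-↭ (w ∘ φ) (concatMap-fibres↭allOWP 1≤n Ts Ts-Unique Ts⇔ pre pre-Unique pre⇔) ⟩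
      ∑ (map (w ∘ φ) (allOWP n))
        ≈⟨ ∑-map (w ∘ φ) (toWeakPartition n) (assignments anyBlock n) ⟩
      ∑ (map (w ∘ φ ∘ toWeakPartition n) (assignments anyBlock n))
        ≈⟨ ∑-cong (assignments anyBlock n) (weight-φ-toWeakPartition c n) ⟩
      ∑ (map (monomial c ∘ blockSizes n) (assignments anyBlock n))
        ≈⟨ cDpow≈∑monomial c n ⟩
      cDpow R D c n                                         ∎)

    cDpow≈∑σTerm : cDpow R D c n ≈ ∑ (map (σTerm R D c n) Ts)
    cDpow≈∑σTerm = trans cDpow≈∑fibres (∑-cong Ts (λ {T} m → trans
      (reflexive (≡.cong (λ k → natScale R k (w T)) (fibre-size 1≤n (Equivalence.to (Ts⇔ T) m) (pre T) (pre-Unique T) (pre⇔ T))))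
      (sym (σTerm≈natScale c n T))))

open Assignments using (fibre-size)

theorem4p5 : {r ℓ : Level} (n : ℕ) → 1 ≤ n →
  -- #φ⁻¹(T) = ∏ σ_i(T), where ps is any duplicate-free enumeration of φ⁻¹(T)
  ((T : Array) → IsSYT n T →
    (ps : List (WeakPartition n)) → Unique ps →
    (∀ p → (p ∈ ps) ⇔ (IsOWP n p × φ p ≡ T)) →
    length ps ≡ σProd n T)
  ×
  -- (cD)^n c in any commutative ring with a derivation D
  ((R : CommutativeRing r ℓ) (D : CommutativeRing.Carrier R → CommutativeRing.Carrier R) →
    IsDerivation R D → (c : CommutativeRing.Carrier R) →
    -- Ts : duplicate-free enumeration of SYT(n)
    (Ts : List Array) → Unique Ts → (∀ T → (T ∈ Ts) ⇔ IsSYT n T) →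
    -- pre T : duplicate-free enumeration of φ⁻¹(T)
    (pre : Array → List (WeakPartition n)) → (∀ T → Unique (pre T)) →
    (∀ T p → (p ∈ pre T) ⇔ (IsOWP n p × φ p ≡ T)) →
    CommutativeRing._≈_ R (cDpow R D c n)
      (ringSum R (map (λ T → natScale R (length (pre T)) (weight R D c n T)) Ts))
    ×
    CommutativeRing._≈_ R (cDpow R D c n) (ringSum R (map (σTerm R D c n) Ts)))
theorem4p5 n 1≤n =
  (λ T ST → fibre-size 1≤n ST) ,
  (λ R D isD c Ts Ts-Unique Ts⇔ pre pre-Unique pre⇔ → let open DifferentialRing R D isD in
     cDpow≈∑fibres 1≤n c Ts Ts-Unique Ts⇔ pre pre-Unique pre⇔ , cDpow≈∑σTerm 1≤n c Ts Ts-Unique Ts⇔ pre pre-Unique pre⇔)
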